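{- Let $0\le l<n$. The number of maximal chains of $R_{n,l}$ is $\binom{n+l}{2l+1}(n-l-1)!$. Explicitly, for $A\in\binom{[n+l]}{2l+1}$ and $\pi\in\mathfrak{S}_{n-l-1}$, define $C(A,\pi)$ as follows: write $A=\{c_1<\cdots<c_{2l+1}\}$, set $a_i:=c_{2i-1}-i+1$ for $1\le i\le l+1$ and $b_i:=c_{2i}-i$ for $1\le i\le l$; let $x:=(\{a_1\},\dots,\{a_{l+1}\})$ and $y:=(\{1,\dots,b_1\},\{b_1+1,\dots,b_2\},\dots,\{b_l+1,\dots,n\})$; write $[n]\setminus\{a_1,\dots,a_{l+1}\}=\{a'_1<\cdots<a'_{n-l-1}\}$; and let $C(A,\pi)$ be the chain starting at $x$ obtained by successively adding the elements $a'_{\pi(1)},\dots,a'_{\pi(n-l-1)}$ (in that order), each to the block in which it lies in $y$. Then $(A,\pi)\mapsto C(A,\pi)$ is a bijection from $\binom{[n+l]}{2l+1}\times\mathfrak{S}_{n-l-1}$ to the set of maximal chains of $R_{n,l}$.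
   Context: $[n]=\{1,\dots,n\}$, $\binom{[m]}{k}$ is the set of $k$-element subsets of $[m]$, and $\mathfrak{S}_m$ is the symmetric group on $[m]$. For $0\le l<n$, $R_{n,l}$ is the poset whose elements are $(l+1)$-tuples $(A_1,\dots,A_{l+1})$ of nonempty subsets of $[n]$ with $\max(A_i)<\min(A_{i+1})$ for all $i\in[l]$, ordered by componentwise containment ($A_i\subseteq B_i$ for all $i$). -}

module Defs where

open import Data.Nat.Base using (ℕ; zero; suc; _∸_; _<ᵇ_; _≤ᵇ_; _≡ᵇ_)
open import Data.Bool.Base using (Bool; true; false; _∧_; if_then_else_)
open import Data.Bool.ListAction using (any)
open import Data.Fin.Base as Fin using (Fin; toℕ; inject₁)
open import Data.Fin.Subset using (Subset; _∈_; _⊆_; Nonempty; _∪_; ∁)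
open import Data.Vec.Base as Vec using (Vec; lookup; tabulate; zipWith)
open import Data.List.Base as List using (List; []; _∷_; _++_; [_]; map; allFin)
open import Data.List.Relation.Unary.All using (All)
open import Data.List.Relation.Unary.Linked using (Linked)
open import Data.List.Membership.Propositional as ListMem using ()
open import Data.Fin.Permutation using (Permutation′; _⟨$⟩ʳ_)
open import Data.Product.Base using (_×_)
open import Data.Sum.Base using (_⊎_)
open import Relation.Binary.PropositionalEquality using (_≡_; _≢_)

-- Convention: [n] = {1,…,n} is modelled by Fin n, the element j : Fin n
-- standing for the number toℕ j + 1 (order-preserving).  A subset of [n]
-- is a Data.Fin.Subset n.

Tuple : ℕ → ℕ → Set
Tuple n l = Vec (Subset n) (suc l)

-- Membership of a tuple in R_{n,l}: all blocks nonempty, and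
-- max(A_i) < min(A_{i+1}), i.e. every element of A_i is below every
-- element of A_{i+1}.
InR : (n l : ℕ) → Tuple n l → Set
InR n l t =
  (∀ (i : Fin (suc l)) → Nonempty (lookup t i)) ×
  (∀ (i : Fin l) {x y : Fin n} →
     x ∈ lookup t (inject₁ i) → y ∈ lookup t (Fin.suc i) → x Fin.< y)

_≤R_ : ∀ {n l} → Tuple n l → Tuple n l → Set
s ≤R t = ∀ i → lookup s i ⊆ lookup t i

_<R_ : ∀ {n l} → Tuple n l → Tuple n l → Set
s <R t = s ≤R t × s ≢ t

Comparable : ∀ {n l} → Tuple n l → Tuple n l → Set
Comparable z w = z ≤R w ⊎ w ≤R z

-- A chain of R_{n,l}, listed in increasing order (a finite chain is the
-- same thing as its increasingly sorted list of elements).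
IsChain : (n l : ℕ) → List (Tuple n l) → Set
IsChain n l L = All (InR n l) L × Linked _<R_ L

-- A maximal chain: a chain such that every element of R_{n,l} comparable
-- with all members of the chain already belongs to it (i.e. the chain is
-- not properly contained in another chain).
IsMaximalChain : (n l : ℕ) → List (Tuple n l) → Set
IsMaximalChain n l L =
  IsChain n l L ×
  (∀ (z : Tuple n l) → InR n l z → All (Comparable z) L → z ListMem.∈ L)

elemsℕ : ∀ {m} → Subset m → List ℕ
elemsℕ Vec.[] = []
elemsℕ (true Vec.∷ s) = 1 ∷ map suc (elemsℕ s)
elemsℕ (false Vec.∷ s) = map suc (elemsℕ s)

odds : List ℕ → List ℕ
evens : List ℕ → List ℕ
odds [] = []
odds (x ∷ xs) = x ∷ evens xs
evens [] = []
evens (x ∷ xs) = odds xs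

subIdx : ℕ → List ℕ → List ℕ
subIdx k [] = []
subIdx k (x ∷ xs) = (x ∸ k) ∷ subIdx (suc k) xs

-- 0-based list lookup with default 0.
nth : List ℕ → ℕ → ℕ
nth [] _ = 0
nth (x ∷ xs) zero = x
nth (x ∷ xs) (suc k) = nth xs k

ofPred : ∀ {n} → (ℕ → Bool) → Subset n
ofPred p = tabulate (λ j → p (suc (toℕ j)))

memᵇ : ∀ {n} → ℕ → Subset n → Bool
memᵇ v s = any (v ≡ᵇ_) (elemsℕ s)

module Construction (n l : ℕ) (A : Subset (n Data.Nat.Base.+ l)) where
  cs : List ℕ
  cs = elemsℕ A

  -- a_i = c_{2i-1} - i + 1   (i = 1 … l+1), as a list a_1, …, a_{l+1}
  as : List ℕ
  as = subIdx 0 (odds cs)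

  -- b_i = c_{2i} - i   (i = 1 … l), as a list b_1, …, b_l
  bs : List ℕ
  bs = subIdx 1 (evens cs)

  x : Tuple n l
  x = tabulate (λ i → ofPred (λ v → v ≡ᵇ nth as (toℕ i)))

  -- y = ({1..b_1}, {b_1+1..b_2}, …, {b_l+1..n}); block i (0-based) is
  -- {v : b_i < v ≤ b_{i+1}} with b_0 = 0, b_{l+1} = n.
  y : Tuple n l
  y = tabulate (λ i → ofPred (λ v →
        (nth (0 ∷ bs) (toℕ i) <ᵇ v) ∧ (v ≤ᵇ nth (bs ++ [ n ]) (toℕ i))))

  as′ : List ℕ
  as′ = elemsℕ (∁ (ofPred {n} (λ v → any (v ≡ᵇ_) as)))

  addTo : ℕ → Tuple n l → Tuple n l
  addTo v t = zipWith (λ yi ti → if memᵇ v yi then ti ∪ ofPred (λ u → u ≡ᵇ v) else ti) y t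

  chainFrom : Tuple n l → List ℕ → List (Tuple n l)
  chainFrom t [] = t ∷ []
  chainFrom t (v ∷ vs) = t ∷ chainFrom (addTo v t) vs

  C : Permutation′ (n ∸ suc l) → List (Tuple n l)
  C π = chainFrom x (map (λ j → nth as′ (toℕ (π ⟨$⟩ʳ j))) (allFin (n ∸ suc l)))

chainC : (n l : ℕ) → Subset (n Data.Nat.Base.+ l) → Permutation′ (n ∸ suc l) → List (Tuple n l)
chainC n l A π = Construction.C n l A π

module Submission where

-- A maximal chain of R_{n,l} starts at a minimal element, necessarily a tuple
-- of singletons ({a_1}, …, {a_{l+1}}), and ends at a maximal one, a splitting
-- of [n] into intervals with right ends b_1 < ⋯ < b_l; the a_i and b_i
-- interlace, a_1 ≤ b_1 < a_2 ≤ ⋯ < a_{l+1}. Every element below the top is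
-- determined by its union, and consecutive unions differ by one point, so the
-- chain inserts the n-l-1 points of [n] ∖ {a_i} one at a time, each into its
-- block of the top. The interlacing sequence is encoded bijectively by the
-- (2l+1)-subset {a_i + i - 1} ∪ {b_i + i} of [n+l], and the insertion order by
-- a permutation, which gives (n+l choose 2l+1)·(n-l-1)! chains.

open import Defs
open import Data.Nat.Base using (ℕ; zero; suc; pred; _+_; _*_; _∸_; _<_; _≤_; _<ᵇ_; _≤ᵇ_; _≡ᵇ_; z≤n; s≤s; _!)
open import Data.Nat.Properties
  using ( ≡ᵇ⇒≡; ≡⇒≡ᵇ; <ᵇ⇒<; <⇒<ᵇ; ≤ᵇ⇒≤; ≤⇒≤ᵇ; _≤?_; <-cmp; suc-injective
        ; ≤-refl; ≤-reflexive; ≤-trans; ≤-antisym; ≤-pred; <-irrefl; <-trans; <-≤-trans; ≤-<-trans; <⇒≤; ≰⇒>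
        ; n≤1+n; n<1+n; m≤n+m; m≤n⇒m<n∨m≡n; +-comm; +-suc; +-identityʳ; +-monoˡ-≤; +-monoʳ-≤
        ; ∸-monoˡ-≤; ∸-monoʳ-<; m+n∸n≡m; m+n∸m≡n; m∸n+n≡m )
open import Data.Nat.Combinatorics using (_C_; nCk+nC[k+1]≡[n+1]C[k+1])
open import Data.Bool.Base using (Bool; true; false; _∧_; _∨_; not; if_then_else_; T)
open import Data.Bool.Properties as Bool using (not-injective; ∧-zeroʳ; ∨-conicalˡ)
open import Data.Bool.ListAction using (any)
open import Data.Fin.Base as Fin using (Fin; toℕ; fromℕ<; inject₁; punchIn)
open import Data.Fin.Properties using (_≟_; any?; toℕ-injective; toℕ<n; toℕ-fromℕ<; toℕ-inject₁; punchIn-injective)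
open import Data.Fin.Subset using (Subset; ∣_∣; Nonempty; ∁; _∪_) renaming (_∈_ to _∈ₛ_)
open import Data.Fin.Subset.Properties using (∣∁p∣≡n∸∣p∣)
open import Data.Fin.Permutation as Perm
  using (Permutation; Permutation′; permutation; _⟨$⟩ʳ_; _⟨$⟩ˡ_; inverseʳ; ↔⇒≡; insert; remove; insert-punchIn; insert-remove)
open import Data.Vec.Base as Vec using (Vec; lookup; tabulate; zipWith)
open import Data.Vec.Properties using (lookup∘tabulate; tabulate∘lookup; tabulate-cong; lookup-map; lookup-zipWith; []=⇒lookup; lookup⇒[]=)
open import Data.List.Base as List using (List; []; _∷_; _++_; [_]; map; length; concatMap; allFin)
open import Data.List.Properties
  using (length-map; length-++; length-tabulate; map-tabulate; map-cong; map-injective; ∷-injective; ∷-injectiveʳ)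
open import Data.List.Relation.Unary.All as All using (All; []; _∷_)
import Data.List.Relation.Unary.All.Properties as All
open import Data.List.Relation.Unary.AllPairs as AllPairs using (AllPairs; []; _∷_)
import Data.List.Relation.Unary.AllPairs.Properties as AllPairs
open import Data.List.Relation.Unary.Any using (here; there)
open import Data.List.Relation.Unary.Linked using (Linked; [-]; _∷_)
open import Data.List.Relation.Unary.Unique.Propositional using (Unique)
import Data.List.Relation.Unary.Unique.Propositional.Properties as Unique
open import Data.List.Membership.Propositional using (_∈_)
open import Data.List.Membership.Propositional.Properties
  using (∈-map⁺; ∈-map⁻; ∈-++⁺ˡ; ∈-++⁺ʳ; ∈-++⁻; ∈-concat⁺′; ∈-concat⁻′; ∈-allFin)
open import Data.Product.Base using (_×_; _,_; proj₁; proj₂; Σ)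
open import Data.Sum.Base using (_⊎_; inj₁; inj₂)
open import Data.Empty using (⊥; ⊥-elim)
open import Data.Unit.Base using (⊤; tt)
open import Function.Bundles using (Injection)
open import Function.Properties.Inverse using (↔⇒↣)
open import Relation.Nullary using (¬_; Dec; does; yes; no)
open import Relation.Nullary.Decidable using (_×-dec_; dec-true; dec-false)
open import Relation.Binary.Definitions using (tri<; tri≈; tri>)
open import Relation.Binary.PropositionalEquality using (_≡_; _≢_; refl; sym; trans; cong; cong₂; subst; subst₂)

T⇒≡true : ∀ {b} → T b → b ≡ true
T⇒≡true {true} _ = refl

≡true⇒T : ∀ {b} → b ≡ true → T b
≡true⇒T refl = tt

true≢false : ∀ {b} → b ≡ true → b ≡ false → ⊥
true≢false refl ()

≡true⇔⇒≡ : ∀ {a b : Bool} → (a ≡ true → b ≡ true) → (b ≡ true → a ≡ true) → a ≡ b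
≡true⇔⇒≡ {true} {true} f g = refl
≡true⇔⇒≡ {true} {false} f g = sym (f refl)
≡true⇔⇒≡ {false} {true} f g = g refl
≡true⇔⇒≡ {false} {false} f g = refl

∧-trueˡ : ∀ {a b} → (a ∧ b) ≡ true → a ≡ true
∧-trueˡ {true} e = refl

∧-trueʳ : ∀ {a b} → (a ∧ b) ≡ true → b ≡ true
∧-trueʳ {true} e = e

∧-true : ∀ {a b} → a ≡ true → b ≡ true → (a ∧ b) ≡ true
∧-true refl refl = refl

∨-true⁻ : ∀ {a b} → (a ∨ b) ≡ true → (a ≡ true) ⊎ (b ≡ true)
∨-true⁻ {true} e = inj₁ refl
∨-true⁻ {false} e = inj₂ e

∨-trueˡ : ∀ {a b} → a ≡ true → (a ∨ b) ≡ true
∨-trueˡ refl = refl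

∨-trueʳ : ∀ {a b} → b ≡ true → (a ∨ b) ≡ true
∨-trueʳ {true} e = refl
∨-trueʳ {false} e = e

∨-∧-inside : ∀ s i e → (e ≡ true → i ≡ true) → ((s ∧ i) ∨ e) ≡ ((s ∨ e) ∧ i)
∨-∧-inside true true true h = refl
∨-∧-inside true true false h = refl
∨-∧-inside true false true h with h refl
... | ()
∨-∧-inside true false false h = refl
∨-∧-inside false true true h = refl
∨-∧-inside false true false h = refl
∨-∧-inside false false true h with h refl
... | ()
∨-∧-inside false false false h = refl

∨-∧-outside : ∀ s i e → (e ≡ true → i ≡ false) → (s ∧ i) ≡ ((s ∨ e) ∧ i)
∨-∧-outside true true true h with h refl
... | ()
∨-∧-outside true true false h = refl
∨-∧-outside true false e h = refl
∨-∧-outside false true true h with h refl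
... | ()
∨-∧-outside false true false h = refl
∨-∧-outside false false true h = refl
∨-∧-outside false false false h = refl

does-true⇒ : ∀ {a} {A : Set a} (a? : Dec A) → does a? ≡ true → A
does-true⇒ (yes a) _ = a

≡ᵇ-refl : ∀ n → (n ≡ᵇ n) ≡ true
≡ᵇ-refl n = T⇒≡true (≡⇒≡ᵇ n n refl)

≡ᵇ-sound : ∀ {m n} → (m ≡ᵇ n) ≡ true → m ≡ n
≡ᵇ-sound {m} {n} e = ≡ᵇ⇒≡ m n (≡true⇒T e)

≡ᵇ-complete : ∀ {m n} → m ≡ n → (m ≡ᵇ n) ≡ true
≡ᵇ-complete {m} refl = ≡ᵇ-refl m

≡ᵇ-false : ∀ {m n} → m ≢ n → (m ≡ᵇ n) ≡ false
≡ᵇ-false {m} {n} m≢n with m ≡ᵇ n in eq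
... | true = ⊥-elim (m≢n (≡ᵇ-sound eq))
... | false = refl

<ᵇ-sound : ∀ {m n} → (m <ᵇ n) ≡ true → m < n
<ᵇ-sound {m} {n} e = <ᵇ⇒< m n (≡true⇒T e)

<ᵇ-complete : ∀ {m n} → m < n → (m <ᵇ n) ≡ true
<ᵇ-complete m<n = T⇒≡true (<⇒<ᵇ m<n)

≤ᵇ-sound : ∀ {m n} → (m ≤ᵇ n) ≡ true → m ≤ n
≤ᵇ-sound {m} {n} e = ≤ᵇ⇒≤ m n (≡true⇒T e)

≤ᵇ-complete : ∀ {m n} → m ≤ n → (m ≤ᵇ n) ≡ true
≤ᵇ-complete m≤n = T⇒≡true (≤⇒≤ᵇ m≤n)

⌜_⌝ : ∀ {n} → Fin n → ℕ
⌜ x ⌝ = suc (toℕ x)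

⌜⌝-injective : ∀ {n} {x y : Fin n} → ⌜ x ⌝ ≡ ⌜ y ⌝ → x ≡ y
⌜⌝-injective e = toℕ-injective (suc-injective e)

⌜⌝≤n : ∀ {n} (x : Fin n) → ⌜ x ⌝ ≤ n
⌜⌝≤n x = toℕ<n x

fromValue : ∀ {n} v → 1 ≤ v → v ≤ n → Σ (Fin n) (λ x → ⌜ x ⌝ ≡ v)
fromValue (suc v) (s≤s z≤n) v≤n = fromℕ< v≤n , cong suc (toℕ-fromℕ< v≤n)

vec-ext : ∀ {a} {A : Set a} {n} {u v : Vec A n} → (∀ i → lookup u i ≡ lookup v i) → u ≡ v
vec-ext {u = u} {v} p = trans (sym (tabulate∘lookup u)) (trans (tabulate-cong p) (tabulate∘lookup v))

∈⇒lookup : ∀ {n} {x : Fin n} {s : Subset n} → x ∈ₛ s → lookup s x ≡ true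
∈⇒lookup = []=⇒lookup

lookup⇒∈ : ∀ {n} {x : Fin n} {s : Subset n} → lookup s x ≡ true → x ∈ₛ s
lookup⇒∈ {x = x} {s} = lookup⇒[]= x s

lookup-ofPred : ∀ {n} (p : ℕ → Bool) (x : Fin n) → lookup (ofPred {n} p) x ≡ p ⌜ x ⌝
lookup-ofPred p x = lookup∘tabulate _ x

any-map-suc : ∀ w (xs : List ℕ) → any (suc w ≡ᵇ_) (map suc xs) ≡ any (w ≡ᵇ_) xs
any-map-suc w [] = refl
any-map-suc w (x ∷ xs) = cong ((w ≡ᵇ x) ∨_) (any-map-suc w xs)

any-zero-positive : ∀ (xs : List ℕ) → All (1 ≤_) xs → any (0 ≡ᵇ_) xs ≡ false
any-zero-positive [] [] = refl
any-zero-positive (suc x ∷ xs) (_ ∷ ps) = any-zero-positive xs ps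

any-true⇒nth : ∀ {v} (xs : List ℕ) → any (v ≡ᵇ_) xs ≡ true → Σ ℕ (λ k → k < length xs × nth xs k ≡ v)
any-true⇒nth {v} (x ∷ xs) e with ∨-true⁻ {v ≡ᵇ x} e
... | inj₁ v≡x = 0 , s≤s z≤n , sym (≡ᵇ-sound v≡x)
... | inj₂ rest with any-true⇒nth xs rest
... | k , k<len , eq = suc k , s≤s k<len , eq

nth⇒any-true : ∀ (xs : List ℕ) k → k < length xs → any (nth xs k ≡ᵇ_) xs ≡ true
nth⇒any-true (x ∷ xs) zero _ = ∨-trueˡ (≡ᵇ-refl x)
nth⇒any-true (x ∷ xs) (suc k) (s≤s k<len) = ∨-trueʳ {nth xs k ≡ᵇ x} (nth⇒any-true xs k k<len)

Ascending : ℕ → List ℕ → Set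
Ascending k [] = ⊤
Ascending k (c ∷ cs) = k ≤ c × Ascending (suc c) cs

Ascending-weaken : ∀ {j k} cs → j ≤ k → Ascending k cs → Ascending j cs
Ascending-weaken [] _ _ = tt
Ascending-weaken (c ∷ cs) j≤k (k≤c , asc) = ≤-trans j≤k k≤c , asc

Ascending-map-suc : ∀ {k} cs → Ascending k cs → Ascending (suc k) (map suc cs)
Ascending-map-suc [] _ = tt
Ascending-map-suc (c ∷ cs) (k≤c , asc) = s≤s k≤c , Ascending-map-suc cs asc

Ascending⇒All≥ : ∀ {k} cs → Ascending k cs → All (k ≤_) cs
Ascending⇒All≥ [] _ = []
Ascending⇒All≥ (c ∷ cs) (k≤c , asc) =
  k≤c ∷ All.map (λ c<d → ≤-trans k≤c (≤-trans (n≤1+n c) c<d)) (Ascending⇒All≥ cs asc)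

nth-All : ∀ {P : ℕ → Set} xs k → All P xs → k < length xs → P (nth xs k)
nth-All (x ∷ xs) zero (p ∷ _) _ = p
nth-All (x ∷ xs) (suc k) (_ ∷ ps) (s≤s k<len) = nth-All xs k ps k<len

nth-ext : ∀ (xs ys : List ℕ) → length xs ≡ length ys → (∀ k → k < length xs → nth xs k ≡ nth ys k) → xs ≡ ys
nth-ext [] [] _ _ = refl
nth-ext (x ∷ xs) (y ∷ ys) e h =
  cong₂ _∷_ (h 0 (s≤s z≤n)) (nth-ext xs ys (suc-injective e) (λ k k<len → h (suc k) (s≤s k<len)))

nth-Ascending-< : ∀ {k} cs i j → Ascending k cs → i < j → j < length cs → nth cs i < nth cs j
nth-Ascending-< (c ∷ cs) zero (suc j) (_ , asc) _ (s≤s j<len) = nth-All cs j (Ascending⇒All≥ cs asc) j<len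
nth-Ascending-< (c ∷ cs) (suc i) (suc j) (_ , asc) (s≤s i<j) (s≤s j<len) = nth-Ascending-< cs i j asc i<j j<len

nth-Ascending-injective : ∀ {k} cs i j → Ascending k cs → i < length cs → j < length cs → nth cs i ≡ nth cs j → i ≡ j
nth-Ascending-injective cs i j asc i<len j<len e with <-cmp i j
... | tri≈ _ i≡j _ = i≡j
... | tri< i<j _ _ = ⊥-elim (<-irrefl e (nth-Ascending-< cs i j asc i<j j<len))
... | tri> _ _ j<i = ⊥-elim (<-irrefl (sym e) (nth-Ascending-< cs j i asc j<i i<len))

nth-tabulate : ∀ {m} (f : Fin m → ℕ) (j : Fin m) → nth (List.tabulate f) (toℕ j) ≡ f j
nth-tabulate f Fin.zero = refl
nth-tabulate f (Fin.suc j) = nth-tabulate (λ x → f (Fin.suc x)) j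

last⊎inject₁ : ∀ {l} (i : Fin (suc l)) → (toℕ i ≡ l) ⊎ Σ (Fin l) (λ i′ → i ≡ inject₁ i′)
last⊎inject₁ {zero} Fin.zero = inj₁ refl
last⊎inject₁ {suc l} Fin.zero = inj₂ (Fin.zero , refl)
last⊎inject₁ {suc l} (Fin.suc i) with last⊎inject₁ i
... | inj₁ e = inj₁ (cong suc e)
... | inj₂ (i′ , e) = inj₂ (Fin.suc i′ , cong Fin.suc e)

nth-++ˡ : ∀ (xs ys : List ℕ) k → k < length xs → nth (xs ++ ys) k ≡ nth xs k
nth-++ˡ (x ∷ xs) ys zero _ = refl
nth-++ˡ (x ∷ xs) ys (suc k) (s≤s k<len) = nth-++ˡ xs ys k k<len

nth-++-length : ∀ (xs : List ℕ) y → nth (xs ++ [ y ]) (length xs) ≡ y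
nth-++-length [] y = refl
nth-++-length (x ∷ xs) y = nth-++-length xs y

elemsℕ-Ascending : ∀ {m} (s : Subset m) → Ascending 1 (elemsℕ s)
elemsℕ-Ascending Vec.[] = tt
elemsℕ-Ascending (true Vec.∷ s) = s≤s z≤n , Ascending-map-suc (elemsℕ s) (elemsℕ-Ascending s)
elemsℕ-Ascending (false Vec.∷ s) =
  Ascending-weaken (map suc (elemsℕ s)) (s≤s z≤n) (Ascending-map-suc (elemsℕ s) (elemsℕ-Ascending s))

elemsℕ-positive : ∀ {m} (s : Subset m) → All (1 ≤_) (elemsℕ s)
elemsℕ-positive s = Ascending⇒All≥ (elemsℕ s) (elemsℕ-Ascending s)

elemsℕ-bounded : ∀ {m} (s : Subset m) → All (_≤ m) (elemsℕ s)
elemsℕ-bounded Vec.[] = []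
elemsℕ-bounded (true Vec.∷ s) = s≤s z≤n ∷ All.map⁺ (All.map s≤s (elemsℕ-bounded s))
elemsℕ-bounded (false Vec.∷ s) = All.map⁺ (All.map s≤s (elemsℕ-bounded s))

length-elemsℕ : ∀ {m} (s : Subset m) → length (elemsℕ s) ≡ ∣ s ∣
length-elemsℕ Vec.[] = refl
length-elemsℕ (true Vec.∷ s) = cong suc (trans (length-map suc (elemsℕ s)) (length-elemsℕ s))
length-elemsℕ (false Vec.∷ s) = trans (length-map suc (elemsℕ s)) (length-elemsℕ s)

memᵇ-lookup : ∀ {m} (s : Subset m) (x : Fin m) → memᵇ ⌜ x ⌝ s ≡ lookup s x
memᵇ-lookup (true Vec.∷ s) Fin.zero = refl
memᵇ-lookup (false Vec.∷ s) Fin.zero =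
  trans (any-map-suc 0 (elemsℕ s)) (any-zero-positive (elemsℕ s) (elemsℕ-positive s))
memᵇ-lookup (b Vec.∷ s) (Fin.suc x) with b
... | true = trans (any-map-suc ⌜ x ⌝ (elemsℕ s)) (memᵇ-lookup s x)
... | false = trans (any-map-suc ⌜ x ⌝ (elemsℕ s)) (memᵇ-lookup s x)

1∉map-suc : ∀ {ys : List ℕ} xs → All (1 ≤_) xs → 1 ∷ ys ≡ map suc xs → ⊥
1∉map-suc (zero ∷ xs) (() ∷ _) e
1∉map-suc (suc x ∷ xs) _ ()

elemsℕ-injective : ∀ {m} (s t : Subset m) → elemsℕ s ≡ elemsℕ t → s ≡ t
elemsℕ-injective Vec.[] Vec.[] e = refl
elemsℕ-injective (true Vec.∷ s) (true Vec.∷ t) e =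
  cong (true Vec.∷_) (elemsℕ-injective s t (map-injective suc-injective (∷-injectiveʳ e)))
elemsℕ-injective (false Vec.∷ s) (false Vec.∷ t) e =
  cong (false Vec.∷_) (elemsℕ-injective s t (map-injective suc-injective e))
elemsℕ-injective (true Vec.∷ s) (false Vec.∷ t) e = ⊥-elim (1∉map-suc (elemsℕ t) (elemsℕ-positive t) e)
elemsℕ-injective (false Vec.∷ s) (true Vec.∷ t) e = ⊥-elim (1∉map-suc (elemsℕ s) (elemsℕ-positive s) (sym e))

Ascending-pred : ∀ {k} cs → Ascending (suc k) cs → Ascending k (map pred cs) × cs ≡ map suc (map pred cs)
Ascending-pred [] _ = tt , refl
Ascending-pred (suc c ∷ cs) (s≤s k≤c , asc) with Ascending-pred cs asc
... | asc′ , e = (k≤c , asc′) , cong (suc c ∷_) e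

All-≤-pred : ∀ {m ds} → All (_≤ suc m) (map suc ds) → All (_≤ m) ds
All-≤-pred p = All.map ≤-pred (All.map⁻ p)

unshift : ∀ {m} cs → Ascending 1 cs → All (_≤ suc m) cs →
  Σ (List ℕ) (λ ds → Ascending 1 ds × All (_≤ m) ds × ((cs ≡ 1 ∷ map suc ds) ⊎ (cs ≡ map suc ds)))
unshift [] _ _ = [] , tt , [] , inj₂ refl
unshift (suc zero ∷ cs) (_ , asc) (_ ∷ bnd) with Ascending-pred cs asc
... | asc′ , e = map pred cs , asc′ , All-≤-pred (subst (All _) e bnd) , inj₁ (cong (1 ∷_) e)
unshift (suc (suc c) ∷ cs) (_ , asc) bnd with Ascending-pred (suc (suc c) ∷ cs) (s≤s (s≤s z≤n) , asc)
... | asc′ , e = map pred (suc (suc c) ∷ cs) , asc′ , All-≤-pred (subst (All _) e bnd) , inj₂ e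

Ascending-bounded-by-0 : ∀ cs → Ascending 1 cs → All (_≤ 0) cs → cs ≡ []
Ascending-bounded-by-0 [] _ _ = refl
Ascending-bounded-by-0 (c ∷ cs) (s≤s _ , _) (() ∷ _)

elemsℕ-ofPred : ∀ m (p : ℕ → Bool) (cs : List ℕ) →
  (∀ (x : Fin m) → p ⌜ x ⌝ ≡ any (⌜ x ⌝ ≡ᵇ_) cs) → Ascending 1 cs → All (_≤ m) cs →
  elemsℕ (ofPred {m} p) ≡ cs
elemsℕ-ofPred zero p cs _ asc bnd = sym (Ascending-bounded-by-0 cs asc bnd)
elemsℕ-ofPred (suc m) p cs hp asc bnd with unshift cs asc bnd
... | ds , asc′ , bnd′ , inj₁ refl =
  trans (cong (λ b → elemsℕ (b Vec.∷ ofPred {m} (λ v → p (suc v)))) (hp Fin.zero))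
        (cong (λ z → 1 ∷ map suc z) (elemsℕ-ofPred m (λ v → p (suc v)) ds hp′ asc′ bnd′))
  where
  hp′ : ∀ (x : Fin m) → p (suc ⌜ x ⌝) ≡ any (⌜ x ⌝ ≡ᵇ_) ds
  hp′ x = trans (hp (Fin.suc x)) (any-map-suc ⌜ x ⌝ ds)
... | ds , asc′ , bnd′ , inj₂ refl =
  trans (cong (λ b → elemsℕ (b Vec.∷ ofPred {m} (λ v → p (suc v))))
              (trans (hp Fin.zero) (trans (any-map-suc 0 ds) (any-zero-positive ds (Ascending⇒All≥ ds asc′)))))
        (cong (map suc) (elemsℕ-ofPred m (λ v → p (suc v)) ds hp′ asc′ bnd′))
  where
  hp′ : ∀ (x : Fin m) → p (suc ⌜ x ⌝) ≡ any (⌜ x ⌝ ≡ᵇ_) ds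
  hp′ x = trans (hp (Fin.suc x)) (any-map-suc ⌜ x ⌝ ds)

elemsℕ-nth : ∀ {m} (s : Subset m) j → j < length (elemsℕ s) →
  Σ (Fin m) (λ x → (⌜ x ⌝ ≡ nth (elemsℕ s) j) × (lookup s x ≡ true))
elemsℕ-nth s j j<len
  with fromValue (nth (elemsℕ s) j) (nth-All (elemsℕ s) j (elemsℕ-positive s) j<len) (nth-All (elemsℕ s) j (elemsℕ-bounded s) j<len)
... | x , ex = x , ex , trans (sym (memᵇ-lookup s x)) (subst (λ v → memᵇ v s ≡ true) (sym ex) (nth⇒any-true (elemsℕ s) j j<len))

elemsℕ-index : ∀ {m} (s : Subset m) x → lookup s x ≡ true →
  Σ ℕ (λ j → (j < length (elemsℕ s)) × (nth (elemsℕ s) j ≡ ⌜ x ⌝))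
elemsℕ-index s x e = any-true⇒nth (elemsℕ s) (trans (memᵇ-lookup s x) e)

-- 0 for the empty subset.
maxValue : ∀ {n} → Subset n → ℕ
maxValue Vec.[] = 0
maxValue (b Vec.∷ s) = bump b (maxValue s)
  where
  bump : Bool → ℕ → ℕ
  bump b (suc k) = suc (suc k)
  bump true zero = 1
  bump false zero = 0

maxValue-upper : ∀ {n} (s : Subset n) x → lookup s x ≡ true → ⌜ x ⌝ ≤ maxValue s
maxValue-upper (true Vec.∷ s) Fin.zero e with maxValue s
... | zero = s≤s z≤n
... | suc k = s≤s z≤n
maxValue-upper (b Vec.∷ s) (Fin.suc x) e with maxValue s | maxValue-upper s x e
... | suc k | ⌜x⌝≤k = s≤s ⌜x⌝≤k

maxValue-suc⇒elem : ∀ {n} (s : Subset n) k → maxValue s ≡ suc k →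
  Σ (Fin n) (λ x → lookup s x ≡ true × ⌜ x ⌝ ≡ suc k)
maxValue-suc⇒elem (b Vec.∷ s) k e with maxValue s in eq
maxValue-suc⇒elem (true Vec.∷ s) zero e | zero = Fin.zero , refl , refl
maxValue-suc⇒elem (b Vec.∷ s) k e | suc k′ with maxValue-suc⇒elem s k′ eq
... | x , x∈s , ex = Fin.suc x , x∈s , trans (cong suc ex) e

maxValue-attained : ∀ {n} (s : Subset n) x → lookup s x ≡ true →
  Σ (Fin n) (λ w → lookup s w ≡ true × ⌜ w ⌝ ≡ maxValue s)
maxValue-attained s x e with maxValue s in eq | maxValue-upper s x e
... | suc k | _ = maxValue-suc⇒elem s k eq

Interlaced : ℕ → ℕ → List ℕ → List ℕ → Set
Interlaced n lo [] _ = ⊥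
Interlaced n lo (a ∷ as) [] = lo < a × a ≤ n × as ≡ []
Interlaced n lo (a ∷ as) (b ∷ bs) = lo < a × a ≤ b × Interlaced n b as bs

double : ℕ → ℕ
double zero = zero
double (suc p) = suc (suc (double p))

2*p+1≡suc-double : ∀ p → 2 * p + 1 ≡ suc (double p)
2*p+1≡suc-double zero = refl
2*p+1≡suc-double (suc p) =
  trans (cong (λ z → suc (z + 1)) (+-suc p (p + 0))) (cong (λ z → suc (suc z)) (2*p+1≡suc-double p))

module _ {n : ℕ} where

  interlaced-nth : ∀ {lo} as bs → Interlaced n lo as bs → ∀ k → k ≤ length bs →
    (nth (lo ∷ bs) k < nth as k) × (nth as k ≤ nth (bs ++ [ n ]) k)
  interlaced-nth (a ∷ as) [] (lo<a , a≤n , _) zero _ = lo<a , a≤n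
  interlaced-nth (a ∷ as) (b ∷ bs) (lo<a , a≤b , _) zero _ = lo<a , a≤b
  interlaced-nth (a ∷ as) (b ∷ bs) (_ , _ , rest) (suc k) (s≤s k≤l) = interlaced-nth as bs rest k k≤l

  interlaced-length : ∀ {lo} as bs → Interlaced n lo as bs → length as ≡ suc (length bs)
  interlaced-length (a ∷ as) [] (_ , _ , refl) = refl
  interlaced-length (a ∷ as) (b ∷ bs) (_ , _ , rest) = cong suc (interlaced-length as bs rest)

  interlaced-lower<n : ∀ {lo} as bs → Interlaced n lo as bs → lo < n
  interlaced-lower<n (a ∷ as) [] (lo<a , a≤n , _) = <-≤-trans lo<a a≤n
  interlaced-lower<n (a ∷ as) (b ∷ bs) (lo<a , a≤b , rest) = <-trans (<-≤-trans lo<a a≤b) (interlaced-lower<n as bs rest)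

  interlaced-Ascending : ∀ {lo} as bs → Interlaced n lo as bs → Ascending (suc lo) as
  interlaced-Ascending (a ∷ as) [] (lo<a , _ , refl) = lo<a , tt
  interlaced-Ascending (a ∷ as) (b ∷ bs) (lo<a , a≤b , rest) =
    lo<a , Ascending-weaken as (s≤s a≤b) (interlaced-Ascending as bs rest)

  interlaced-bounded : ∀ {lo} as bs → Interlaced n lo as bs → All (_≤ n) as
  interlaced-bounded (a ∷ as) [] (_ , a≤n , refl) = a≤n ∷ []
  interlaced-bounded (a ∷ as) (b ∷ bs) (_ , a≤b , rest) =
    ≤-trans a≤b (<⇒≤ (interlaced-lower<n as bs rest)) ∷ interlaced-bounded as bs rest

-- Inverse of a_i = c_{2i-1} - (i-1), b_i = c_{2i} - i (with offset k):
-- it merges the interlaced a's and b's into c₁ < c₂ < ⋯ < c_{2l+1}.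
encode : ℕ → List ℕ → List ℕ → List ℕ
encode k [] _ = []
encode k (a ∷ as) [] = (a + k) ∷ []
encode k (a ∷ as) (b ∷ bs) = (a + k) ∷ (b + suc k) ∷ encode (suc k) as bs

module _ {n : ℕ} where

  odds-encode : ∀ {lo} k as bs → Interlaced n lo as bs → subIdx k (odds (encode k as bs)) ≡ as
  odds-encode k (a ∷ as) [] (_ , _ , refl) = cong (_∷ []) (m+n∸n≡m a k)
  odds-encode k (a ∷ as) (b ∷ bs) (_ , _ , rest) = cong₂ _∷_ (m+n∸n≡m a k) (odds-encode (suc k) as bs rest)

  evens-encode : ∀ {lo} k as bs → Interlaced n lo as bs → subIdx (suc k) (evens (encode k as bs)) ≡ bs
  evens-encode k (a ∷ as) [] (_ , _ , refl) = refl
  evens-encode k (a ∷ as) (b ∷ bs) (_ , _ , rest) = cong₂ _∷_ (m+n∸n≡m b (suc k)) (evens-encode (suc k) as bs rest)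

  encode-Ascending : ∀ {lo} k as bs → Interlaced n lo as bs → Ascending (suc (lo + k)) (encode k as bs)
  encode-Ascending k (a ∷ as) [] (lo<a , _ , refl) = +-monoˡ-≤ k lo<a , tt
  encode-Ascending k (a ∷ as) (b ∷ bs) (lo<a , a≤b , rest) =
    +-monoˡ-≤ k lo<a , subst (suc (a + k) ≤_) (sym (+-suc b k)) (s≤s (+-monoˡ-≤ k a≤b)) , encode-Ascending (suc k) as bs rest

  encode-bounded : ∀ {lo} k as bs → Interlaced n lo as bs → All (_≤ k + (length bs + n)) (encode k as bs)
  encode-bounded k (a ∷ as) [] (_ , a≤n , refl) = subst (a + k ≤_) (+-comm n k) (+-monoˡ-≤ k a≤n) ∷ []
  encode-bounded k (a ∷ as) (b ∷ bs) (_ , a≤b , rest) =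
    ≤-trans (+-monoˡ-≤ k (≤-trans a≤b (<⇒≤ b<n))) n+k≤ ∷
    ≤-trans (subst (_≤ n + k) (sym (+-suc b k)) (+-monoˡ-≤ k b<n)) n+k≤ ∷
    subst (λ z → All (_≤ z) (encode (suc k) as bs)) (sym (+-suc k (length bs + n))) (encode-bounded (suc k) as bs rest)
    where
    b<n : b < n
    b<n = interlaced-lower<n as bs rest
    n+k≤ : n + k ≤ k + (suc (length bs) + n)
    n+k≤ = subst (_≤ k + (suc (length bs) + n)) (+-comm k n) (+-monoʳ-≤ k (m≤n+m n (suc (length bs))))

  length-encode : ∀ {lo} k as bs → Interlaced n lo as bs → length (encode k as bs) ≡ suc (double (length bs))
  length-encode k (a ∷ as) [] (_ , _ , refl) = refl
  length-encode k (a ∷ as) (b ∷ bs) (_ , _ , rest) = cong (λ z → suc (suc z)) (length-encode (suc k) as bs rest)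

encode-decode : ∀ p {c} k cs → Ascending c cs → k < c → length cs ≡ suc (double p) →
  encode k (subIdx k (odds cs)) (subIdx (suc k) (evens cs)) ≡ cs
encode-decode zero k (c₀ ∷ []) (c≤c₀ , _) k<c _ = cong (_∷ []) (m∸n+n≡m (≤-trans (<⇒≤ k<c) c≤c₀))
encode-decode (suc p) k (c₀ ∷ c₁ ∷ cs) (c≤c₀ , c₀<c₁ , asc) k<c e =
  cong₂ _∷_ (m∸n+n≡m k≤c₀) (cong₂ _∷_ (m∸n+n≡m k<c₁)
    (encode-decode p (suc k) cs asc (s≤s k<c₁) (suc-injective (suc-injective e))))
  where
  k≤c₀ = ≤-trans (<⇒≤ k<c) c≤c₀
  k<c₁ = ≤-trans (s≤s k≤c₀) c₀<c₁

module _ {n : ℕ} where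

  decode-interlaced : ∀ p {c lo} k cs → Ascending c cs → k < c → lo < c ∸ k → length cs ≡ suc (double p) →
    All (_≤ k + (p + n)) cs → Interlaced n lo (subIdx k (odds cs)) (subIdx (suc k) (evens cs))
  decode-interlaced zero k (c₀ ∷ []) (c≤c₀ , _) _ lo< _ (c₀≤ ∷ []) =
    ≤-trans lo< (∸-monoˡ-≤ k c≤c₀) , subst (c₀ ∸ k ≤_) (m+n∸m≡n k n) (∸-monoˡ-≤ k c₀≤) , refl
  decode-interlaced (suc p) k (c₀ ∷ c₁ ∷ c₂ ∷ cs) (c≤c₀ , c₀<c₁ , asc) k<c lo< e (_ ∷ _ ∷ bnd) =
    ≤-trans lo< (∸-monoˡ-≤ k c≤c₀) , ∸-monoˡ-≤ (suc k) c₀<c₁ ,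
    decode-interlaced p (suc k) (c₂ ∷ cs) asc (s≤s k<c₁) (∸-monoʳ-< (n<1+n k) k<c₁)
      (suc-injective (suc-injective e))
      (subst (λ z → All (_≤ z) (c₂ ∷ cs)) (+-suc k (p + n)) bnd)
    where
    k<c₁ = ≤-trans (s≤s (≤-trans (<⇒≤ k<c) c≤c₀)) c₀<c₁

  length-decode-evens : ∀ p k cs → length cs ≡ suc (double p) → length (subIdx k (evens cs)) ≡ p
  length-decode-evens zero k (c₀ ∷ []) _ = refl
  length-decode-evens (suc p) k (c₀ ∷ c₁ ∷ c₂ ∷ cs) e =
    cong suc (length-decode-evens p (suc k) (c₂ ∷ cs) (suc-injective (suc-injective e)))

bit : ∀ {n l} → Tuple n l → Fin (suc l) → Fin n → Bool
bit t i x = lookup (lookup t i) x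

module _ {n l : ℕ} where

  ≤R-refl : ∀ {t : Tuple n l} → t ≤R t
  ≤R-refl i x∈ = x∈

  ≤R-trans : ∀ {s t u : Tuple n l} → s ≤R t → t ≤R u → s ≤R u
  ≤R-trans s≤t t≤u i x∈ = t≤u i (s≤t i x∈)

  ≤R⇒bit : ∀ {s t : Tuple n l} → s ≤R t → ∀ i x → bit s i x ≡ true → bit t i x ≡ true
  ≤R⇒bit s≤t i x e = ∈⇒lookup (s≤t i (lookup⇒∈ e))

  bit⇒≤R : ∀ {s t : Tuple n l} → (∀ i x → bit s i x ≡ true → bit t i x ≡ true) → s ≤R t
  bit⇒≤R h i {x} x∈ = lookup⇒∈ (h i x (∈⇒lookup x∈))

  tuple-ext : ∀ {s t : Tuple n l} → (∀ i x → bit s i x ≡ bit t i x) → s ≡ t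
  tuple-ext h = vec-ext (λ i → vec-ext (h i))

  InR-≤R : ∀ {z t : Tuple n l} → InR n l t → (∀ i → Nonempty (lookup z i)) → z ≤R t → InR n l z
  InR-≤R (_ , ordered) nonempty z≤t = nonempty , λ i x∈ y∈ → ordered i (z≤t (inject₁ i) x∈) (z≤t (Fin.suc i) y∈)

  lastOf : Tuple n l → List (Tuple n l) → Tuple n l
  lastOf t [] = t
  lastOf t (t′ ∷ ts) = lastOf t′ ts

  lastOf-∈ : ∀ (t : Tuple n l) ts → lastOf t ts ∈ (t ∷ ts)
  lastOf-∈ t [] = here refl
  lastOf-∈ t (t′ ∷ ts) = there (lastOf-∈ t′ ts)

  chain-head-least : ∀ {t : Tuple n l} {ts} → Linked _<R_ (t ∷ ts) → All (t ≤R_) (t ∷ ts)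
  chain-head-least {t} {[]} _ = ≤R-refl {t} ∷ []
  chain-head-least {t} {t′ ∷ ts} (t<t′ ∷ linked) with chain-head-least linked
  ... | _ ∷ t′≤ = ≤R-refl {t} ∷ proj₁ t<t′ ∷ All.map (λ {u} → ≤R-trans {t} {t′} {u} (proj₁ t<t′)) t′≤

  chain-last-greatest : ∀ {t : Tuple n l} {ts} → Linked _<R_ (t ∷ ts) → All (_≤R lastOf t ts) (t ∷ ts)
  chain-last-greatest {t} {[]} _ = ≤R-refl {t} ∷ []
  chain-last-greatest {t} {t′ ∷ ts} (t<t′ ∷ linked) with chain-last-greatest linked
  ... | t′≤ ∷ ≤last = ≤R-trans {t} {t′} {lastOf t′ ts} (proj₁ t<t′) t′≤ ∷ t′≤ ∷ ≤last

  removeAt : Tuple n l → Fin (suc l) → Fin n → Tuple n l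
  removeAt t i w = tabulate (λ j → tabulate (λ x → bit t j x ∧ not (does (j ≟ i) ∧ does (x ≟ w))))

  bit-removeAt : ∀ t i w j x → bit (removeAt t i w) j x ≡ (bit t j x ∧ not (does (j ≟ i) ∧ does (x ≟ w)))
  bit-removeAt t i w j x =
    trans (cong (λ s → lookup s x) (lookup∘tabulate (λ j → tabulate (λ x → bit t j x ∧ not (does (j ≟ i) ∧ does (x ≟ w)))) j))
          (lookup∘tabulate (λ x → bit t j x ∧ not (does (j ≟ i) ∧ does (x ≟ w))) x)

  removeAt-≤R : ∀ t i w → removeAt t i w ≤R t
  removeAt-≤R t i w = bit⇒≤R {s = removeAt t i w} {t} λ j x e → ∧-trueˡ (trans (sym (bit-removeAt t i w j x)) e)

  removeAt-removed : ∀ t i w → bit (removeAt t i w) i w ≡ false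
  removeAt-removed t i w =
    trans (bit-removeAt t i w i w)
      (subst₂ (λ p q → (bit t i w ∧ not (p ∧ q)) ≡ false) (sym (dec-true (i ≟ i) refl)) (sym (dec-true (w ≟ w) refl)) (∧-zeroʳ (bit t i w)))

  removeAt-kept : ∀ t i w j x → bit t j x ≡ true → (j ≢ i) ⊎ (x ≢ w) → bit (removeAt t i w) j x ≡ true
  removeAt-kept t i w j x x∈ j≢i⊎x≢w = trans (bit-removeAt t i w j x) (∧-true x∈ (cong not (not-both j≢i⊎x≢w)))
    where
    not-both : (j ≢ i) ⊎ (x ≢ w) → (does (j ≟ i) ∧ does (x ≟ w)) ≡ false
    not-both (inj₁ j≢i) = cong (_∧ does (x ≟ w)) (dec-false (j ≟ i) j≢i)
    not-both (inj₂ x≢w) = trans (cong (does (j ≟ i) ∧_) (dec-false (x ≟ w) x≢w)) (∧-zeroʳ _)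

  insertAt : Tuple n l → Fin (suc l) → Fin n → Tuple n l
  insertAt t i w = tabulate (λ j → tabulate (λ x → bit t j x ∨ (does (j ≟ i) ∧ does (x ≟ w))))

  bit-insertAt : ∀ t i w j x → bit (insertAt t i w) j x ≡ (bit t j x ∨ (does (j ≟ i) ∧ does (x ≟ w)))
  bit-insertAt t i w j x =
    trans (cong (λ s → lookup s x) (lookup∘tabulate (λ j → tabulate (λ x → bit t j x ∨ (does (j ≟ i) ∧ does (x ≟ w)))) j))
          (lookup∘tabulate (λ x → bit t j x ∨ (does (j ≟ i) ∧ does (x ≟ w))) x)

  ≤R-insertAt : ∀ t i w → t ≤R insertAt t i w
  ≤R-insertAt t i w = bit⇒≤R {s = t} {insertAt t i w} λ j x e → trans (bit-insertAt t i w j x) (∨-trueˡ e)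

  insertAt-inserted : ∀ t i w → bit (insertAt t i w) i w ≡ true
  insertAt-inserted t i w =
    trans (bit-insertAt t i w i w)
      (∨-trueʳ {bit t i w} (cong₂ _∧_ (dec-true (i ≟ i) refl) (dec-true (w ≟ w) refl)))

  insertAt⁻ : ∀ t i w j x → bit (insertAt t i w) j x ≡ true → (bit t j x ≡ true) ⊎ (j ≡ i × x ≡ w)
  insertAt⁻ t i w j x e with ∨-true⁻ {bit t j x} (trans (sym (bit-insertAt t i w j x)) e)
  ... | inj₁ x∈ = inj₁ x∈
  ... | inj₂ both = inj₂ (does-true⇒ (j ≟ i) (∧-trueˡ both) , does-true⇒ (x ≟ w) (∧-trueʳ {does (j ≟ i)} both))

-- Block k of y is the interval
-- (lower k, upper k], and restrict S is y with every block cut down to S;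
-- every element of R below y is restrict of its union (support), so a chain
-- below y is a chain of subsets of [n].
module FrameDefs (n l : ℕ) (as bs : List ℕ) where

  a : ℕ → ℕ
  a k = nth as k

  lower : ℕ → ℕ
  lower k = nth (0 ∷ bs) k

  upper : ℕ → ℕ
  upper k = nth (bs ++ [ n ]) k

  InBlock : ℕ → ℕ → Set
  InBlock k v = (lower k < v) × (v ≤ upper k)

  inBlockᵇ : ℕ → ℕ → Bool
  inBlockᵇ k v = (nth (0 ∷ bs) k <ᵇ v) ∧ (v ≤ᵇ nth (bs ++ [ n ]) k)

  Points : Set
  Points = ℕ → Bool

  restrict : Points → Tuple n l
  restrict S = tabulate (λ i → ofPred (λ v → S v ∧ inBlockᵇ (toℕ i) v))

  _⊆ᵛ_ : Points → Points → Set
  S ⊆ᵛ S′ = ∀ (x : Fin n) → S ⌜ x ⌝ ≡ true → S′ ⌜ x ⌝ ≡ true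

  _≈ᵛ_ : Points → Points → Set
  S ≈ᵛ S′ = ∀ (x : Fin n) → S ⌜ x ⌝ ≡ S′ ⌜ x ⌝

  yT : Tuple n l
  yT = restrict (λ _ → true)

  addTo : ℕ → Tuple n l → Tuple n l
  addTo v t = zipWith (λ yi ti → if memᵇ v yi then ti ∪ ofPred (λ u → u ≡ᵇ v) else ti) yT t

  chainFrom : Tuple n l → List ℕ → List (Tuple n l)
  chainFrom t [] = t ∷ []
  chainFrom t (v ∷ vs) = t ∷ chainFrom (addTo v t) vs

  add : Points → ℕ → Points
  add S v u = S u ∨ (u ≡ᵇ v)

  InRange : ℕ → Set
  InRange v = Σ (Fin n) (λ w → ⌜ w ⌝ ≡ v)

  chainOf : Points → List ℕ → List (Tuple n l)
  chainOfTail : Points → List ℕ → List (Tuple n l)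
  chainOf S vs = restrict S ∷ chainOfTail S vs
  chainOfTail S [] = []
  chainOfTail S (v ∷ vs) = chainOf (add S v) vs

  Fresh : Points → List ℕ → Set
  Fresh S [] = ⊤
  Fresh S (v ∷ vs) = InRange v × (S v ≡ false) × Fresh (add S v) vs

  final : Points → List ℕ → Points
  final S [] = S
  final S (v ∷ vs) = final (add S v) vs

  xT : Tuple n l
  xT = tabulate (λ i → ofPred (λ v → v ≡ᵇ nth as (toℕ i)))

  Sx : Points
  Sx v = any (v ≡ᵇ_) as

  support : ∀ {k} → Vec (Subset n) k → Points
  support Vec.[] v = false
  support (s Vec.∷ ss) v = memᵇ v s ∨ support ss v

module Frame (n l : ℕ) (as bs : List ℕ) (interlaced : Interlaced n 0 as bs) (length-bs : length bs ≡ l) where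

  open FrameDefs n l as bs public

  a∈block : ∀ k → k ≤ l → (lower k < a k) × (a k ≤ upper k)
  a∈block k le = interlaced-nth as bs interlaced k (subst (k ≤_) (sym length-bs) le)

  lower-suc : ∀ k → k < l → lower (suc k) ≡ upper k
  lower-suc k lt = sym (nth-++ˡ bs [ n ] k (subst (k <_) (sym length-bs) lt))

  upper-last : upper l ≡ n
  upper-last = subst (λ m → nth (bs ++ [ n ]) m ≡ n) length-bs (nth-++-length bs n)

  upper-< : ∀ k → k < l → upper k < upper (suc k)
  upper-< k lt = subst (_< upper (suc k)) (lower-suc k lt) (<-≤-trans (proj₁ (a∈block (suc k) lt)) (proj₂ (a∈block (suc k) lt)))

  upper-mono : ∀ {k j} → k ≤ j → j ≤ l → upper k ≤ upper j
  upper-mono {j = zero} z≤n _ = ≤-refl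
  upper-mono {k} {suc j} k≤j+1 j<l with m≤n⇒m<n∨m≡n k≤j+1
  ... | inj₂ refl = ≤-refl
  ... | inj₁ (s≤s k≤j) = ≤-trans (upper-mono k≤j (<⇒≤ j<l)) (<⇒≤ (upper-< j j<l))

  upper≤n : ∀ k → k ≤ l → upper k ≤ n
  upper≤n k le = subst (upper k ≤_) upper-last (upper-mono le ≤-refl)

  a-range : ∀ k → k ≤ l → (1 ≤ a k) × (a k ≤ n)
  a-range k le = ≤-trans (s≤s z≤n) (proj₁ (a∈block k le)) , ≤-trans (proj₂ (a∈block k le)) (upper≤n k le)

  upper≤lower : ∀ k j → k < j → j ≤ l → upper k ≤ lower j
  upper≤lower k (suc j) (s≤s kj) jl = subst (upper k ≤_) (sym (lower-suc j jl)) (upper-mono kj (<⇒≤ jl))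

  inBlockᵇ-sound : ∀ k v → inBlockᵇ k v ≡ true → InBlock k v
  inBlockᵇ-sound k v e = <ᵇ-sound {lower k} {v} (∧-trueˡ e) , ≤ᵇ-sound {v} {upper k} (∧-trueʳ {lower k <ᵇ v} e)

  inBlockᵇ-complete : ∀ k v → InBlock k v → inBlockᵇ k v ≡ true
  inBlockᵇ-complete k v (p , q) = ∧-true {lower k <ᵇ v} {v ≤ᵇ upper k} (<ᵇ-complete p) (≤ᵇ-complete q)

  block-unique : ∀ k j v → k ≤ l → j ≤ l → InBlock k v → InBlock j v → k ≡ j
  block-unique k j v kl jl (p1 , q1) (p2 , q2) with <-cmp k j
  ... | tri≈ _ e _ = e
  ... | tri< lt _ _ = ⊥-elim (<-irrefl refl (≤-<-trans (≤-trans q1 (upper≤lower k j lt jl)) p2))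
  ... | tri> _ _ gt = ⊥-elim (<-irrefl refl (≤-<-trans (≤-trans q2 (upper≤lower j k gt kl)) p1))

  block-exists-from : ∀ v → v ≤ n → ∀ d k → d + k ≡ l → lower k < v → Σ ℕ (λ j → (j ≤ l) × InBlock j v)
  block-exists-from v vn zero k refl lo = k , ≤-refl , lo , subst (v ≤_) (sym upper-last) vn
  block-exists-from v vn (suc d) k e lo with v ≤? upper k
  ... | yes le = k , subst (k ≤_) e (m≤n+m k (suc d)) , lo , le
  ... | no nle = block-exists-from v vn d (suc k) (trans (+-suc d k) e)
                   (subst (_< v) (sym (lower-suc k (subst (k <_) e (s≤s (m≤n+m k d))))) (≰⇒> nle))

  block-exists : ∀ v → 1 ≤ v → v ≤ n → Σ (Fin (suc l)) (λ i → InBlock (toℕ i) v)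
  block-exists v pv vn with block-exists-from v vn l 0 (+-identityʳ l) pv
  ... | j , jl , I = fromℕ< (s≤s jl) , subst (λ z → InBlock z v) (sym (toℕ-fromℕ< (s≤s jl))) I

  toℕ≤l : (i : Fin (suc l)) → toℕ i ≤ l
  toℕ≤l i = ≤-pred (toℕ<n i)

  bit-restrict : ∀ S i x → bit (restrict S) i x ≡ (S ⌜ x ⌝ ∧ inBlockᵇ (toℕ i) ⌜ x ⌝)
  bit-restrict S i x = trans (cong (λ s → lookup s x) (lookup∘tabulate (λ i → ofPred (λ v → S v ∧ inBlockᵇ (toℕ i) v)) i))
      (lookup-ofPred (λ v → S v ∧ inBlockᵇ (toℕ i) v) x)

  blockOf : (x : Fin n) → Σ (Fin (suc l)) (λ i → inBlockᵇ (toℕ i) ⌜ x ⌝ ≡ true)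
  blockOf x with block-exists ⌜ x ⌝ (s≤s z≤n) (⌜⌝≤n x)
  ... | i , I = i , inBlockᵇ-complete (toℕ i) ⌜ x ⌝ I

  ⊆ᵛ-antisym : ∀ S S′ → S ⊆ᵛ S′ → S′ ⊆ᵛ S → S ≈ᵛ S′
  ⊆ᵛ-antisym S S′ p q x = ≡true⇔⇒≡ {S ⌜ x ⌝} {S′ ⌜ x ⌝} (p x) (q x)

  bit-restrict⁻ : ∀ S i x → bit (restrict S) i x ≡ true → (S ⌜ x ⌝ ≡ true) × (inBlockᵇ (toℕ i) ⌜ x ⌝ ≡ true)
  bit-restrict⁻ S i x e = ∧-trueˡ e' , ∧-trueʳ {S ⌜ x ⌝} e'
    where e' = trans (sym (bit-restrict S i x)) e

  bit-restrict⁺ : ∀ S i x → S ⌜ x ⌝ ≡ true → inBlockᵇ (toℕ i) ⌜ x ⌝ ≡ true → bit (restrict S) i x ≡ true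
  bit-restrict⁺ S i x p q = trans (bit-restrict S i x) (∧-true p q)

  restrict-mono : ∀ S S′ → S ⊆ᵛ S′ → restrict S ≤R restrict S′
  restrict-mono S S′ h = bit⇒≤R {s = restrict S} {t = restrict S′} λ i x e →
    bit-restrict⁺ S′ i x (h x (proj₁ (bit-restrict⁻ S i x e))) (proj₂ (bit-restrict⁻ S i x e))

  restrict-mono⁻ : ∀ S S′ → restrict S ≤R restrict S′ → S ⊆ᵛ S′
  restrict-mono⁻ S S′ le x e with blockOf x
  ... | i , ei = proj₁ (bit-restrict⁻ S′ i x (≤R⇒bit {s = restrict S} {t = restrict S′} le i x (bit-restrict⁺ S i x e ei)))

  restrict-cong : ∀ S S′ → S ≈ᵛ S′ → restrict S ≡ restrict S′
  restrict-cong S S′ h = tuple-ext λ i x → trans (bit-restrict S i x) (trans (cong (_∧ inBlockᵇ (toℕ i) ⌜ x ⌝) (h x)) (sym (bit-restrict S′ i x)))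

  restrict-injective : ∀ S S′ → restrict S ≡ restrict S′ → S ≈ᵛ S′
  restrict-injective S S′ e = ⊆ᵛ-antisym S S′ (restrict-mono⁻ S S′ (subst (restrict S ≤R_) e (≤R-refl {t = restrict S})))
                                (restrict-mono⁻ S′ S (subst (_≤R restrict S) e (≤R-refl {t = restrict S})))

  blocks-ordered : ∀ (i : Fin l) (x y : Fin n) → inBlockᵇ (toℕ (inject₁ i)) ⌜ x ⌝ ≡ true → inBlockᵇ (suc (toℕ i)) ⌜ y ⌝ ≡ true → x Fin.< y
  blocks-ordered i x y ex ey = ≤-pred (≤-<-trans hx (subst (_< ⌜ y ⌝) (lower-suc (toℕ i) (toℕ<n i)) (proj₁ (inBlockᵇ-sound (suc (toℕ i)) ⌜ y ⌝ ey))))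
    where
    hx : ⌜ x ⌝ ≤ upper (toℕ i)
    hx = subst (λ z → ⌜ x ⌝ ≤ upper z) (toℕ-inject₁ i) (proj₂ (inBlockᵇ-sound (toℕ (inject₁ i)) ⌜ x ⌝ ex))

  restrict-InR : ∀ S → (∀ k → k ≤ l → S (a k) ≡ true) → InR n l (restrict S)
  restrict-InR S hS = ne , ord
    where
    ne : ∀ i → Nonempty (lookup (restrict S) i)
    ne i with fromValue (a (toℕ i)) (proj₁ (a-range (toℕ i) (toℕ≤l i))) (proj₂ (a-range (toℕ i) (toℕ≤l i)))
    ... | w , ew = w , lookup⇒∈ (bit-restrict⁺ S i w (subst (λ v → S v ≡ true) (sym ew) (hS (toℕ i) (toℕ≤l i)))
                            (subst (λ v → inBlockᵇ (toℕ i) v ≡ true) (sym ew) (inBlockᵇ-complete (toℕ i) (a (toℕ i)) (a∈block (toℕ i) (toℕ≤l i)))))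
    ord : ∀ (i : Fin l) {x y : Fin n} → x ∈ₛ lookup (restrict S) (inject₁ i) → y ∈ₛ lookup (restrict S) (Fin.suc i) → x Fin.< y
    ord i {x} {y} xi yi = blocks-ordered i x y (proj₂ (bit-restrict⁻ S (inject₁ i) x (∈⇒lookup xi))) (proj₂ (bit-restrict⁻ S (Fin.suc i) y (∈⇒lookup yi)))

  yT-InR : InR n l yT
  yT-InR = restrict-InR (λ _ → true) (λ _ _ → refl)

  memᵇ-yT : ∀ i (w : Fin n) → memᵇ ⌜ w ⌝ (lookup yT i) ≡ inBlockᵇ (toℕ i) ⌜ w ⌝
  memᵇ-yT i w = trans (memᵇ-lookup (lookup yT i) w) (bit-restrict (λ _ → true) i w)

  addTo-restrict : ∀ S (w : Fin n) → addTo ⌜ w ⌝ (restrict S) ≡ restrict (add S ⌜ w ⌝)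
  addTo-restrict S w = tuple-ext λ i x →
    trans (cong (λ s → lookup s x) (lookup-zipWith _ i yT (restrict S)))
          (trans (main i x) (sym (bit-restrict (add S ⌜ w ⌝) i x)))
    where
    main : ∀ i x → lookup (if memᵇ ⌜ w ⌝ (lookup yT i) then lookup (restrict S) i ∪ ofPred (λ u → u ≡ᵇ ⌜ w ⌝) else lookup (restrict S) i) x
                   ≡ ((S ⌜ x ⌝ ∨ (⌜ x ⌝ ≡ᵇ ⌜ w ⌝)) ∧ inBlockᵇ (toℕ i) ⌜ x ⌝)
    main i x rewrite memᵇ-yT i w with inBlockᵇ (toℕ i) ⌜ w ⌝ in eI
    ... | true = trans (lookup-zipWith _∨_ x (lookup (restrict S) i) (ofPred (λ u → u ≡ᵇ ⌜ w ⌝)))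
                   (trans (cong₂ _∨_ (bit-restrict S i x) (lookup-ofPred (λ u → u ≡ᵇ ⌜ w ⌝) x))
                     (∨-∧-inside (S ⌜ x ⌝) (inBlockᵇ (toℕ i) ⌜ x ⌝) (⌜ x ⌝ ≡ᵇ ⌜ w ⌝)
                         (λ e → subst (λ v → inBlockᵇ (toℕ i) v ≡ true) (sym (≡ᵇ-sound {⌜ x ⌝} {⌜ w ⌝} e)) eI)))
    ... | false = trans (bit-restrict S i x)
                   (∨-∧-outside (S ⌜ x ⌝) (inBlockᵇ (toℕ i) ⌜ x ⌝) (⌜ x ⌝ ≡ᵇ ⌜ w ⌝)
                       (λ e → subst (λ v → inBlockᵇ (toℕ i) v ≡ false) (sym (≡ᵇ-sound {⌜ x ⌝} {⌜ w ⌝} e)) eI))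

  chainFrom-restrict : ∀ S vs → All InRange vs → chainFrom (restrict S) vs ≡ chainOf S vs
  chainFrom-restrict S [] _ = refl
  chainFrom-restrict S (v ∷ vs) ((w , refl) ∷ rs) = cong (restrict S ∷_)
      (trans (cong (λ t → chainFrom t vs) (addTo-restrict S w)) (chainFrom-restrict (add S ⌜ w ⌝) vs rs))

  Fresh⇒InRange : ∀ S vs → Fresh S vs → All InRange vs
  Fresh⇒InRange S [] _ = []
  Fresh⇒InRange S (v ∷ vs) (r , _ , f) = r ∷ Fresh⇒InRange (add S v) vs f

  ⊆ᵛ-add : ∀ S v → S ⊆ᵛ add S v
  ⊆ᵛ-add S v x e = ∨-trueˡ e

  restrict-<R-add : ∀ S (w : Fin n) → S ⌜ w ⌝ ≡ false → restrict S <R restrict (add S ⌜ w ⌝)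
  restrict-<R-add S w f = restrict-mono S (add S ⌜ w ⌝) (⊆ᵛ-add S ⌜ w ⌝) , λ e → true≢false
      (trans (restrict-injective S (add S ⌜ w ⌝) e w) (∨-trueʳ {S ⌜ w ⌝} (≡ᵇ-refl ⌜ w ⌝))) f

  chainOf-InR : ∀ S vs → (∀ k → k ≤ l → S (a k) ≡ true) → Fresh S vs → All (InR n l) (chainOf S vs)
  chainOf-InR S [] hS _ = restrict-InR S hS ∷ []
  chainOf-InR S (v ∷ vs) hS (_ , _ , f) = restrict-InR S hS ∷ chainOf-InR (add S v) vs (λ k le → ∨-trueˡ (hS k le)) f

  chainOf-Linked : ∀ S vs → Fresh S vs → Linked _<R_ (chainOf S vs)
  chainOf-Linked S [] _ = [-]
  chainOf-Linked S (v ∷ vs) ((w , refl) , fS , f) = restrict-<R-add S w fS ∷ chainOf-Linked (add S ⌜ w ⌝) vs f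

  All-chainOf-final : ∀ {P : Tuple n l → Set} S vs → All P (chainOf S vs) → P (restrict (final S vs))
  All-chainOf-final S [] (p ∷ _) = p
  All-chainOf-final S (v ∷ vs) (_ ∷ ps) = All-chainOf-final (add S v) vs ps

  bit-xT : ∀ i x → bit xT i x ≡ (⌜ x ⌝ ≡ᵇ a (toℕ i))
  bit-xT i x = trans (cong (λ s → lookup s x) (lookup∘tabulate (λ i → ofPred (λ v → v ≡ᵇ nth as (toℕ i))) i)) (lookup-ofPred (λ v → v ≡ᵇ nth as (toℕ i)) x)

  length-as : length as ≡ suc l
  length-as = trans (interlaced-length as bs interlaced) (cong suc length-bs)

  Sx-a : ∀ k → k ≤ l → Sx (a k) ≡ true
  Sx-a k le = nth⇒any-true as k (subst (k <_) (sym length-as) (s≤s le))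

  xT≡restrict-Sx : xT ≡ restrict Sx
  xT≡restrict-Sx = tuple-ext λ i x → trans (bit-xT i x) (trans (≡true⇔⇒≡ (fw i x) (bw i x)) (sym (bit-restrict Sx i x)))
    where
    k≤ = toℕ≤l
    fw : ∀ i x → (⌜ x ⌝ ≡ᵇ a (toℕ i)) ≡ true → (Sx ⌜ x ⌝ ∧ inBlockᵇ (toℕ i) ⌜ x ⌝) ≡ true
    fw i x e with ≡ᵇ-sound {⌜ x ⌝} {a (toℕ i)} e
    ... | ex = ∧-true (subst (λ v → Sx v ≡ true) (sym ex) (Sx-a (toℕ i) (k≤ i)))
                   (subst (λ v → inBlockᵇ (toℕ i) v ≡ true) (sym ex) (inBlockᵇ-complete (toℕ i) (a (toℕ i)) (a∈block (toℕ i) (k≤ i))))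
    bw : ∀ i x → (Sx ⌜ x ⌝ ∧ inBlockᵇ (toℕ i) ⌜ x ⌝) ≡ true → (⌜ x ⌝ ≡ᵇ a (toℕ i)) ≡ true
    bw i x e with any-true⇒nth as (∧-trueˡ e)
    ... | j , jlt , ej = ≡ᵇ-complete (trans (sym ej) (cong a (sym kj)))
      where
      jl : j ≤ l
      jl = ≤-pred (subst (j <_) length-as jlt)
      kj : toℕ i ≡ j
      kj = block-unique (toℕ i) j ⌜ x ⌝ (k≤ i) jl (inBlockᵇ-sound (toℕ i) ⌜ x ⌝ (∧-trueʳ {Sx ⌜ x ⌝} e)) (subst (InBlock j) ej (a∈block j jl))

  yT-inBlock : ∀ i x → bit yT i x ≡ true → InBlock (toℕ i) ⌜ x ⌝
  yT-inBlock i x e = inBlockᵇ-sound (toℕ i) ⌜ x ⌝ (trans (sym (bit-restrict (λ _ → true) i x)) e)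

  inBlock⇒yT : ∀ i x → InBlock (toℕ i) ⌜ x ⌝ → bit yT i x ≡ true
  inBlock⇒yT i x x∈ = trans (bit-restrict (λ _ → true) i x) (inBlockᵇ-complete (toℕ i) ⌜ x ⌝ x∈)

  upper∈yT : ∀ (i : Fin l) → Σ (Fin n) (λ w → (⌜ w ⌝ ≡ upper (toℕ i)) × (bit yT (inject₁ i) w ≡ true))
  upper∈yT i with fromValue (upper k) (≤-trans (proj₁ (a-range k k≤l)) (proj₂ (a∈block k k≤l))) (upper≤n k k≤l)
    where k = toℕ i
          k≤l = <⇒≤ (toℕ<n i)
  ... | w , ew = w , ew , inBlock⇒yT (inject₁ i) w (subst₂ InBlock (sym (toℕ-inject₁ i)) (sym ew) (lower<upper , ≤-refl))
    where
    lower<upper : lower (toℕ i) < upper (toℕ i)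
    lower<upper = <-≤-trans (proj₁ (a∈block (toℕ i) (<⇒≤ (toℕ<n i)))) (proj₂ (a∈block (toℕ i) (<⇒≤ (toℕ<n i))))

  1+upper∈yT : ∀ (i : Fin l) → Σ (Fin n) (λ w → (⌜ w ⌝ ≡ suc (upper (toℕ i))) × (bit yT (Fin.suc i) w ≡ true))
  1+upper∈yT i with fromValue (suc (upper (toℕ i))) (s≤s z≤n) (≤-trans (upper-< (toℕ i) (toℕ<n i)) (upper≤n (suc (toℕ i)) (toℕ<n i)))
  ... | w , ew = w , ew , inBlock⇒yT (Fin.suc i) w
    (subst (InBlock (suc (toℕ i))) (sym ew) (subst (_< suc (upper (toℕ i))) (sym (lower-suc (toℕ i) (toℕ<n i))) ≤-refl , upper-< (toℕ i) (toℕ<n i)))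

  -- The ends upper k < upper k + 1 of consecutive blocks of yT pin down every
  -- block of an element of R above yT.
  yT-maximal : ∀ {z} → InR n l z → yT ≤R z → z ≤R yT
  yT-maximal {z} (_ , ordered) yT≤z = bit⇒≤R {s = z} {t = yT} λ i x e → inBlock⇒yT i x (above-lower i x e , below-upper i x e)
    where
    above-lower : ∀ i x → bit z i x ≡ true → lower (toℕ i) < ⌜ x ⌝
    above-lower Fin.zero x e = s≤s z≤n
    above-lower (Fin.suc i) x e with upper∈yT i
    ... | w , ew , w∈ =
      subst (_< ⌜ x ⌝) (trans ew (sym (lower-suc (toℕ i) (toℕ<n i)))) (s≤s (ordered i (yT≤z (inject₁ i) (lookup⇒∈ w∈)) (lookup⇒∈ e)))
    below-upper : ∀ i x → bit z i x ≡ true → ⌜ x ⌝ ≤ upper (toℕ i)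
    below-upper i x e with last⊎inject₁ i
    ... | inj₁ i≡l = subst (⌜ x ⌝ ≤_) (sym (trans (cong upper i≡l) upper-last)) (⌜⌝≤n x)
    ... | inj₂ (i′ , refl) with 1+upper∈yT i′
    ... | w , ew , w∈ = subst (λ q → ⌜ x ⌝ ≤ upper q) (sym (toℕ-inject₁ i′))
                          (≤-pred (subst (⌜ x ⌝ <_) ew (s≤s (ordered i′ (lookup⇒∈ e) (yT≤z (Fin.suc i′) (lookup⇒∈ w∈))))))

  xT-minimal : ∀ {z} → InR n l z → z ≤R xT → xT ≤R z
  xT-minimal {z} (ne , ord) le = bit⇒≤R {s = xT} {t = z} λ i u e → go i u e (ne i)
    where
    go : ∀ i u → bit xT i u ≡ true → Nonempty (lookup z i) → bit z i u ≡ true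
    go i u e (w , w∈) = subst (λ q → bit z i q ≡ true) (sym uw) (∈⇒lookup w∈)
      where
      wx : bit xT i w ≡ true
      wx = ≤R⇒bit {s = z} {t = xT} le i w (∈⇒lookup w∈)
      uw : u ≡ w
      uw = ⌜⌝-injective (trans (≡ᵇ-sound {⌜ u ⌝} {a (toℕ i)} (trans (sym (bit-xT i u)) e)) (sym (≡ᵇ-sound {⌜ w ⌝} {a (toℕ i)} (trans (sym (bit-xT i w)) wx))))

  support⁻ : ∀ {k} (z : Vec (Subset n) k) x → support z ⌜ x ⌝ ≡ true → Σ (Fin k) (λ i → lookup (lookup z i) x ≡ true)
  support⁻ (s Vec.∷ z) x e with ∨-true⁻ {memᵇ ⌜ x ⌝ s} e
  ... | inj₁ e1 = Fin.zero , trans (sym (memᵇ-lookup s x)) e1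
  ... | inj₂ e2 with support⁻ z x e2
  ... | i , p = Fin.suc i , p

  support⁺ : ∀ {k} (z : Vec (Subset n) k) i x → lookup (lookup z i) x ≡ true → support z ⌜ x ⌝ ≡ true
  support⁺ (s Vec.∷ z) Fin.zero x e = ∨-trueˡ (trans (memᵇ-lookup s x) e)
  support⁺ (s Vec.∷ z) (Fin.suc i) x e = ∨-trueʳ {memᵇ ⌜ x ⌝ s} (support⁺ z i x e)

  ≤yT⇒inBlock : ∀ {z} → z ≤R yT → ∀ i x → bit z i x ≡ true → inBlockᵇ (toℕ i) ⌜ x ⌝ ≡ true
  ≤yT⇒inBlock {z} le i x e = trans (sym (bit-restrict (λ _ → true) i x)) (≤R⇒bit {s = z} {t = yT} le i x e)

  ≤yT⇒≡restrict-support : ∀ {z} → z ≤R yT → z ≡ restrict (support z)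
  ≤yT⇒≡restrict-support {z} le = tuple-ext λ i x → trans (≡true⇔⇒≡ (fw i x) (bw i x)) (sym (bit-restrict (support z) i x))
    where
    fw : ∀ i x → bit z i x ≡ true → (support z ⌜ x ⌝ ∧ inBlockᵇ (toℕ i) ⌜ x ⌝) ≡ true
    fw i x e = ∧-true {support z ⌜ x ⌝} {inBlockᵇ (toℕ i) ⌜ x ⌝} (support⁺ z i x e) (≤yT⇒inBlock {z} le i x e)
    bw : ∀ i x → (support z ⌜ x ⌝ ∧ inBlockᵇ (toℕ i) ⌜ x ⌝) ≡ true → bit z i x ≡ true
    bw i x e with support⁻ z x (∧-trueˡ e)
    ... | j , ej = subst (λ q → bit z q x ≡ true) ji ej
      where
      ji : j ≡ i
      ji = toℕ-injective
          (block-unique (toℕ j) (toℕ i) ⌜ x ⌝ (toℕ≤l j) (toℕ≤l i)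
            (inBlockᵇ-sound (toℕ j) ⌜ x ⌝ (≤yT⇒inBlock {z} le j x ej)) (inBlockᵇ-sound (toℕ i) ⌜ x ⌝ (∧-trueʳ {support z ⌜ x ⌝} e)))

  -- A Z with S ⊆ Z comparable with restrict (add S w) is ⊆ S or ⊇ add S w, so
  -- by induction Z is one of the sets along the chain.
  comparable⇒∈chainOf : ∀ vs S Z → Fresh S vs → S ⊆ᵛ Z → Z ⊆ᵛ final S vs →
    All (Comparable (restrict Z)) (chainOf S vs) → restrict Z ∈ chainOf S vs
  comparable⇒∈chainOf [] S Z _ p q _ = here (restrict-cong Z S (⊆ᵛ-antisym Z S q p))
  comparable⇒∈chainOf (v ∷ vs) S Z ((w , refl) , fS , f) p q (_ ∷ cmp@(c ∷ _)) with c
  ... | inj₂ le = there (comparable⇒∈chainOf vs (add S ⌜ w ⌝) Z f (restrict-mono⁻ (add S ⌜ w ⌝) Z le) q cmp)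
  ... | inj₁ le with Z ⌜ w ⌝ in eZ
  ...   | true = there (here (restrict-cong Z (add S ⌜ w ⌝) (⊆ᵛ-antisym Z (add S ⌜ w ⌝) (restrict-mono⁻ Z (add S ⌜ w ⌝) le) r)))
    where
    r : add S ⌜ w ⌝ ⊆ᵛ Z
    r x e with ∨-true⁻ {S ⌜ x ⌝} e
    ... | inj₁ e1 = p x e1
    ... | inj₂ e2 = subst (λ u → Z u ≡ true) (sym (≡ᵇ-sound e2)) eZ
  ...   | false = here (restrict-cong Z S (⊆ᵛ-antisym Z S r p))
    where
    r : Z ⊆ᵛ S
    r x e with ∨-true⁻ {S ⌜ x ⌝} (restrict-mono⁻ Z (add S ⌜ w ⌝) le x e)
    ... | inj₁ e1 = e1
    ... | inj₂ e2 = ⊥-elim (true≢false (subst (λ u → Z u ≡ true) (≡ᵇ-sound e2) e) eZ)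

  -- Comparable with the whole chain, z lies between xT and yT, so it is
  -- restrict of a support between Sx and final Sx vs.
  chainOf-maximal : ∀ vs → Fresh Sx vs → (∀ x → final Sx vs ⌜ x ⌝ ≡ true) →
    ∀ z → InR n l z → All (Comparable z) (chainOf Sx vs) → z ∈ chainOf Sx vs
  chainOf-maximal vs fresh covers z z-InR comparable@(z~x ∷ _) =
    subst (_∈ chainOf Sx vs) (sym z≡) (comparable⇒∈chainOf vs Sx (support z) fresh Sx⊆ (λ x _ → covers x) comparable′)
    where
    z≤yT : z ≤R yT
    z≤yT with subst (Comparable z) (restrict-cong (final Sx vs) (λ _ → true) covers) (All-chainOf-final Sx vs comparable)
    ... | inj₁ z≤ = z≤
    ... | inj₂ ≥z = yT-maximal {z} z-InR ≥z
    z≡ : z ≡ restrict (support z)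
    z≡ = ≤yT⇒≡restrict-support z≤yT
    xT≤z : Comparable z (restrict Sx) → xT ≤R z
    xT≤z (inj₁ z≤x) = xT-minimal {z} z-InR (subst (z ≤R_) (sym xT≡restrict-Sx) z≤x)
    xT≤z (inj₂ x≤z) = subst (_≤R z) (sym xT≡restrict-Sx) x≤z
    Sx⊆ : Sx ⊆ᵛ support z
    Sx⊆ = restrict-mono⁻ Sx (support z) (subst₂ _≤R_ xT≡restrict-Sx z≡ (xT≤z z~x))
    comparable′ : All (Comparable (restrict (support z))) (chainOf Sx vs)
    comparable′ = subst (λ q → All (Comparable q) (chainOf Sx vs)) z≡ comparable

  lastOf-chainOf : ∀ S vs → lastOf (restrict S) (chainOfTail S vs) ≡ restrict (final S vs)
  lastOf-chainOf S [] = refl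
  lastOf-chainOf S (v ∷ vs) = lastOf-chainOf (add S v) vs

  chainOf-injective : ∀ S vs vs' → Fresh S vs → Fresh S vs' → chainOf S vs ≡ chainOf S vs' → vs ≡ vs'
  chainOf-injective S [] [] _ _ _ = refl
  chainOf-injective S [] (v' ∷ vs') _ _ ()
  chainOf-injective S (v ∷ vs) [] _ _ ()
  chainOf-injective S (v ∷ vs) (v' ∷ vs') ((w , refl) , fS , f) (_ , fS' , f') e = go vv
    where
    tl : chainOf (add S v) vs ≡ chainOf (add S v') vs'
    tl = cong (λ { [] → [] ; (_ ∷ t) → t }) e
    hd : restrict (add S v) ≡ restrict (add S v')
    hd = cong (λ { [] → restrict S ; (h ∷ _) → h }) tl
    vv : v ≡ v'
    vv with ∨-true⁻ {S ⌜ w ⌝} (trans (sym (restrict-injective (add S v) (add S v') hd w)) (∨-trueʳ {S ⌜ w ⌝} (≡ᵇ-refl ⌜ w ⌝)))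
    ... | inj₁ e1 = ⊥-elim (true≢false e1 fS)
    ... | inj₂ e2 = ≡ᵇ-sound {⌜ w ⌝} {v'} e2
    go : v ≡ v' → (v ∷ vs) ≡ (v' ∷ vs')
    go refl = cong (v ∷_) (chainOf-injective (add S v) vs vs' f f' tl)

  add-cong : ∀ S S′ v → S ≈ᵛ S′ → add S v ≈ᵛ add S′ v
  add-cong S S′ v h x = cong (_∨ (⌜ x ⌝ ≡ᵇ v)) (h x)

  chainOf-cong : ∀ S S′ vs → S ≈ᵛ S′ → chainOf S vs ≡ chainOf S′ vs
  chainOf-cong S S′ [] h = cong (_∷ []) (restrict-cong S S′ h)
  chainOf-cong S S′ (v ∷ vs) h = cong₂ _∷_ (restrict-cong S S′ h) (chainOf-cong (add S v) (add S′ v) vs (add-cong S S′ v h))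

  Fresh-cong : ∀ S S′ vs → S ≈ᵛ S′ → Fresh S vs → Fresh S′ vs
  Fresh-cong S S′ [] h _ = tt
  Fresh-cong S S′ (v ∷ vs) h ((w , refl) , f , fr) = (w , refl) , trans (sym (h w)) f , Fresh-cong (add S v) (add S′ v) vs (add-cong S S′ v h) fr

  final-cong : ∀ S S′ vs → S ≈ᵛ S′ → final S vs ≈ᵛ final S′ vs
  final-cong S S′ [] h = h
  final-cong S S′ (v ∷ vs) h = final-cong (add S v) (add S′ v) vs (add-cong S S′ v h)

  Fresh⇒∉ : ∀ S ws u → Fresh S ws → S u ≡ true → All (u ≢_) ws
  Fresh⇒∉ S [] u _ _ = []
  Fresh⇒∉ S (w ∷ ws) u (_ , f , fr) e = (λ eq → true≢false (subst (λ q → S q ≡ true) eq e) f) ∷ Fresh⇒∉ (add S w) ws u fr (∨-trueˡ e)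

  Fresh-distinct : ∀ S vs → Fresh S vs → AllPairs _≢_ vs
  Fresh-distinct S [] _ = []
  Fresh-distinct S (v ∷ vs) (r , f , fr) = Fresh⇒∉ (add S v) vs v fr (∨-trueʳ {S v} (≡ᵇ-refl v)) ∷ Fresh-distinct (add S v) vs fr

  Fresh⇒outside : ∀ S vs → Fresh S vs → All (λ v → InRange v × (S v ≡ false)) vs
  Fresh⇒outside S [] _ = []
  Fresh⇒outside S (v ∷ vs) (r , f , fr) = (r , f) ∷ mapA (Fresh⇒outside (add S v) vs fr)
    where
    mapA : ∀ {ws} → All (λ w → InRange w × (add S v w ≡ false)) ws → All (λ w → InRange w × (S w ≡ false)) ws
    mapA [] = []
    mapA ((r' , f') ∷ ps) = (r' , ∨-conicalˡ _ _ f') ∷ mapA ps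

  final⁻ : ∀ S vs u → final S vs u ≡ true → (S u ≡ true) ⊎ Σ ℕ (λ k → (k < length vs) × (nth vs k ≡ u))
  final⁻ S [] u e = inj₁ e
  final⁻ S (v ∷ vs) u e with final⁻ (add S v) vs u e
  ... | inj₂ (k , lt , ek) = inj₂ (suc k , s≤s lt , ek)
  ... | inj₁ e1 with ∨-true⁻ {S u} e1
  ... | inj₁ e2 = inj₁ e2
  ... | inj₂ e3 = inj₂ (0 , s≤s z≤n , sym (≡ᵇ-sound {u} {v} e3))

  Fresh-intro : ∀ S vs → All (λ v → InRange v × (S v ≡ false)) vs → AllPairs _≢_ vs → Fresh S vs
  Fresh-intro S [] _ _ = tt
  Fresh-intro S (v ∷ vs) ((r , f) ∷ ps) (v∉ ∷ distinct) = r , f , Fresh-intro (add S v) vs (outside′ ps v∉) distinct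
    where
    outside′ : ∀ {ws} → All (λ w → InRange w × (S w ≡ false)) ws → All (v ≢_) ws →
      All (λ w → InRange w × (add S v w ≡ false)) ws
    outside′ [] [] = []
    outside′ {w ∷ _} ((r′ , f′) ∷ ps′) (v≢w ∷ v∉′) =
      (r′ , subst (λ b → (b ∨ (w ≡ᵇ v)) ≡ false) (sym f′) (≡ᵇ-false (λ e → v≢w (sym e)))) ∷ outside′ ps′ v∉′

  final-⊇ : ∀ S vs u → S u ≡ true → final S vs u ≡ true
  final-⊇ S [] u e = e
  final-⊇ S (v ∷ vs) u e = final-⊇ (add S v) vs u (∨-trueˡ e)

  final-∋ : ∀ S vs k u → k < length vs → nth vs k ≡ u → final S vs u ≡ true
  final-∋ S (v ∷ vs) zero u _ e = final-⊇ (add S v) vs u (∨-trueʳ {S u} (≡ᵇ-complete (sym e)))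
  final-∋ S (v ∷ vs) (suc k) u (s≤s lt) e = final-∋ (add S v) vs k u lt e

module C = Construction

nth-map-allFin : ∀ {m} (f : Fin m → ℕ) k → nth (map f (allFin m)) (toℕ k) ≡ f k
nth-map-allFin f k = trans (cong (λ z → nth z (toℕ k)) (map-tabulate (λ x → x) f)) (nth-tabulate f k)

length-map-allFin : ∀ {m} (f : Fin m → ℕ) → length (map f (allFin m)) ≡ m
length-map-allFin {m} f = trans (length-map f (allFin m)) (length-tabulate {n = m} (λ x → x))

decode-frame : ∀ n l (A : Subset (n + l)) → ∣ A ∣ ≡ 2 * l + 1 →
  Interlaced n 0 (C.as n l A) (C.bs n l A) × (length (C.bs n l A) ≡ l)
decode-frame n l A |A|≡ =
  decode-interlaced {n} l {1} {0} 0 (elemsℕ A) (elemsℕ-Ascending A) (s≤s z≤n) (s≤s z≤n) length-cs bounded ,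
  length-decode-evens {n} l 1 (elemsℕ A) length-cs
  where
  length-cs : length (elemsℕ A) ≡ suc (double l)
  length-cs = trans (length-elemsℕ A) (trans |A|≡ (2*p+1≡suc-double l))
  bounded : All (_≤ 0 + (l + n)) (elemsℕ A)
  bounded = subst (λ z → All (_≤ z) (elemsℕ A)) (+-comm n l) (elemsℕ-bounded A)

module FrameOf (n l : ℕ) (A : Subset (n + l)) (|A|≡ : ∣ A ∣ ≡ 2 * l + 1) where

  frame : Interlaced n 0 (C.as n l A) (C.bs n l A) × (length (C.bs n l A) ≡ l)
  frame = decode-frame n l A |A|≡

  open Frame n l (C.as n l A) (C.bs n l A) (proj₁ frame) (proj₂ frame) public

  m : ℕ
  m = n ∸ suc l

  as′ : List ℕ
  as′ = C.as′ n l A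

  ∣Sx∣≡ : ∣ ofPred {n} Sx ∣ ≡ suc l
  ∣Sx∣≡ = trans (sym (length-elemsℕ (ofPred {n} Sx)))
    (trans (cong length (elemsℕ-ofPred n Sx (C.as n l A) (λ x → refl) (interlaced-Ascending _ _ (proj₁ frame)) (interlaced-bounded _ _ (proj₁ frame))))
      length-as)

  length-as′ : length as′ ≡ m
  length-as′ = trans (length-elemsℕ (∁ (ofPred {n} Sx))) (trans (∣∁p∣≡n∸∣p∣ (ofPred {n} Sx)) (cong (n ∸_) ∣Sx∣≡))

  lookup-∁Sx : ∀ x → lookup (∁ (ofPred {n} Sx)) x ≡ not (Sx ⌜ x ⌝)
  lookup-∁Sx x = trans (lookup-map x not (ofPred {n} Sx)) (cong not (lookup-ofPred Sx x))

  as′-nth : ∀ j → j < length as′ → Σ (Fin n) (λ x → (⌜ x ⌝ ≡ nth as′ j) × (Sx ⌜ x ⌝ ≡ false))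
  as′-nth j j<len with elemsℕ-nth (∁ (ofPred {n} Sx)) j j<len
  ... | x , ex , x∈ = x , ex , not-injective (trans (sym (lookup-∁Sx x)) x∈)

  as′-index : ∀ x → Sx ⌜ x ⌝ ≡ false → Σ ℕ (λ j → (j < length as′) × (nth as′ j ≡ ⌜ x ⌝))
  as′-index x e = elemsℕ-index (∁ (ofPred {n} Sx)) x (trans (lookup-∁Sx x) (cong not e))

  as′-injective : ∀ i j → i < length as′ → j < length as′ → nth as′ i ≡ nth as′ j → i ≡ j
  as′-injective i j = nth-Ascending-injective as′ i j (elemsℕ-Ascending (∁ (ofPred {n} Sx)))

  added : Permutation′ m → List ℕ
  added π = map (λ j → nth as′ (toℕ (π ⟨$⟩ʳ j))) (allFin m)

  module _ (π : Permutation′ m) where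

    π-index< : ∀ j → toℕ (π ⟨$⟩ʳ j) < length as′
    π-index< j = subst (toℕ (π ⟨$⟩ʳ j) <_) (sym length-as′) (toℕ<n (π ⟨$⟩ʳ j))

    added-Fresh : Fresh Sx (added π)
    added-Fresh = Fresh-intro Sx (added π) (All.map⁺ (All.universal outside (allFin m))) (Unique.map⁺ injective (Unique.allFin⁺ m))
      where
      outside : ∀ j → InRange (nth as′ (toℕ (π ⟨$⟩ʳ j))) × (Sx (nth as′ (toℕ (π ⟨$⟩ʳ j))) ≡ false)
      outside j with as′-nth (toℕ (π ⟨$⟩ʳ j)) (π-index< j)
      ... | x , ex , x∉ = (x , ex) , subst (λ v → Sx v ≡ false) ex x∉
      injective : ∀ {i j} → nth as′ (toℕ (π ⟨$⟩ʳ i)) ≡ nth as′ (toℕ (π ⟨$⟩ʳ j)) → i ≡ j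
      injective {i} {j} e = Injection.injective (↔⇒↣ π) (toℕ-injective (as′-injective _ _ (π-index< i) (π-index< j) e))

    added-covers : ∀ x → final Sx (added π) ⌜ x ⌝ ≡ true
    added-covers x with Sx ⌜ x ⌝ in x∈
    ... | true = final-⊇ Sx (added π) ⌜ x ⌝ x∈
    ... | false with as′-index x x∈
    ... | j , j<len , ej =
      final-∋ Sx (added π) (toℕ k) ⌜ x ⌝ k<len
        (trans (nth-map-allFin _ k) (trans (cong (λ q → nth as′ (toℕ q)) (inverseʳ π)) (trans (cong (nth as′) (toℕ-fromℕ< j<m)) ej)))
      where
      j<m : j < m
      j<m = subst (j <_) length-as′ j<len
      k : Fin m
      k = π ⟨$⟩ˡ fromℕ< j<m
      k<len : toℕ k < length (added π)
      k<len = subst (toℕ k <_) (sym (length-map-allFin _)) (toℕ<n k)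

  Construction-chainFrom≡chainFrom : ∀ t vs → C.chainFrom n l A t vs ≡ chainFrom t vs
  Construction-chainFrom≡chainFrom t [] = refl
  Construction-chainFrom≡chainFrom t (v ∷ vs) = cong (t ∷_) (Construction-chainFrom≡chainFrom _ vs)

  chainC≡chainOf : ∀ π → chainC n l A π ≡ chainOf Sx (added π)
  chainC≡chainOf π =
    trans (Construction-chainFrom≡chainFrom _ (added π))
      (trans (cong (λ t → chainFrom t (added π)) xT≡restrict-Sx)
        (chainFrom-restrict Sx (added π) (Fresh⇒InRange Sx (added π) (added-Fresh π))))

  chainC-maximal : ∀ π → IsMaximalChain n l (chainC n l A π)
  chainC-maximal π = subst (IsMaximalChain n l) (sym (chainC≡chainOf π))
    ((chainOf-InR Sx (added π) Sx-a (added-Fresh π) , chainOf-Linked Sx (added π) (added-Fresh π)) ,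
     chainOf-maximal (added π) (added-Fresh π) (added-covers π))

  lastOf-chain≡yT : ∀ π → lastOf (restrict Sx) (chainOfTail Sx (added π)) ≡ yT
  lastOf-chain≡yT π = trans (lastOf-chainOf Sx (added π)) (restrict-cong (final Sx (added π)) (λ _ → true) (added-covers π))

module Compare (n l : ℕ) (A A′ : Subset (n + l)) (|A|≡ : ∣ A ∣ ≡ 2 * l + 1) (|A′|≡ : ∣ A′ ∣ ≡ 2 * l + 1) where
  module F = FrameOf n l A |A|≡
  module F′ = FrameOf n l A′ |A′|≡

  toFin≤l : ∀ k → k ≤ l → Σ (Fin (suc l)) (λ i → toℕ i ≡ k)
  toFin≤l k k≤l = fromℕ< (s≤s k≤l) , toℕ-fromℕ< (s≤s k≤l)

  xT≡⇒a≡ : F.xT ≡ F′.xT → ∀ k → k ≤ l → F.a k ≡ F′.a k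
  xT≡⇒a≡ e k k≤l with toFin≤l k k≤l | fromValue (F.a k) (proj₁ (F.a-range k k≤l)) (proj₂ (F.a-range k k≤l))
  ... | i , refl | w , ew = trans (sym ew) (≡ᵇ-sound (trans (sym (F′.bit-xT i w)) w∈x′))
    where
    w∈x′ : bit F′.xT i w ≡ true
    w∈x′ = subst (λ t → bit t i w ≡ true) e (trans (F.bit-xT i w) (≡ᵇ-complete ew))

  xT≡⇒as≡ : F.xT ≡ F′.xT → C.as n l A ≡ C.as n l A′
  xT≡⇒as≡ e = nth-ext _ _ (trans F.length-as (sym F′.length-as))
    (λ k k<len → xT≡⇒a≡ e k (≤-pred (subst (k <_) F.length-as k<len)))

  -- upper k is the largest element of the k-th block of yT.
  yT≡⇒upper≤ : F.yT ≡ F′.yT → ∀ k → k < l → F.upper k ≤ F′.upper k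
  yT≡⇒upper≤ e k k<l with F.upper∈yT (fromℕ< k<l)
  ... | w , ew , w∈y = subst₂ _≤_ (trans ew (cong F.upper i≡k)) (cong F′.upper (trans (toℕ-inject₁ i) i≡k))
                         (proj₂ (F′.yT-inBlock (inject₁ i) w (subst (λ t → bit t (inject₁ i) w ≡ true) e w∈y)))
    where
    i = fromℕ< k<l
    i≡k = toℕ-fromℕ< k<l

  elemsℕ≡encode : elemsℕ A ≡ encode 0 (C.as n l A) (C.bs n l A)
  elemsℕ≡encode =
    sym (encode-decode l {1} 0 (elemsℕ A) (elemsℕ-Ascending A) (s≤s z≤n) (trans (length-elemsℕ A) (trans |A|≡ (2*p+1≡suc-double l))))

chainC-injective : ∀ n l (A A′ : Subset (n + l)) → ∣ A ∣ ≡ 2 * l + 1 → ∣ A′ ∣ ≡ 2 * l + 1 →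
  (π π′ : Permutation′ (n ∸ suc l)) → chainC n l A π ≡ chainC n l A′ π′ →
  (A ≡ A′) × (∀ i → π ⟨$⟩ʳ i ≡ π′ ⟨$⟩ʳ i)
chainC-injective n l A A′ |A|≡ |A′|≡ π π′ e = A≡A′ , π≈π′
  where
  open Compare n l A A′ |A|≡ |A′|≡
  module K′ = Compare n l A′ A |A′|≡ |A|≡
  chains≡ : F.chainOf F.Sx (F.added π) ≡ F′.chainOf F′.Sx (F′.added π′)
  chains≡ = trans (sym (F.chainC≡chainOf π)) (trans e (F′.chainC≡chainOf π′))
  xT≡ : F.xT ≡ F′.xT
  xT≡ = trans F.xT≡restrict-Sx (trans (proj₁ (∷-injective chains≡)) (sym F′.xT≡restrict-Sx))
  yT≡ : F.yT ≡ F′.yT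
  yT≡ = trans (sym (F.lastOf-chain≡yT π))
          (trans (cong₂ lastOf (proj₁ (∷-injective chains≡)) (proj₂ (∷-injective chains≡))) (F′.lastOf-chain≡yT π′))
  bs≡ : C.bs n l A ≡ C.bs n l A′
  bs≡ = nth-ext _ _ (trans (proj₂ F.frame) (sym (proj₂ F′.frame))) λ k k<len →
    let k<l = subst (k <_) (proj₂ F.frame) k<len
    in trans (sym (nth-++ˡ (C.bs n l A) [ n ] k k<len))
         (trans (≤-antisym (yT≡⇒upper≤ yT≡ k k<l) (K′.yT≡⇒upper≤ (sym yT≡) k k<l))
           (nth-++ˡ (C.bs n l A′) [ n ] k (subst (k <_) (sym (proj₂ F′.frame)) k<l)))
  A≡A′ : A ≡ A′
  A≡A′ = elemsℕ-injective A A′ (trans elemsℕ≡encode (trans (cong₂ (encode 0) (xT≡⇒as≡ xT≡) bs≡) (sym K′.elemsℕ≡encode)))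
  added≡ : F.added π ≡ F.added π′
  added≡ = F.chainOf-injective F.Sx (F.added π) (F.added π′) (F.added-Fresh π) (F.added-Fresh π′)
             (trans (sym (F.chainC≡chainOf π)) (trans (trans e (cong (λ B → chainC n l B π′) (sym A≡A′))) (F.chainC≡chainOf π′)))
  π≈π′ : ∀ i → π ⟨$⟩ʳ i ≡ π′ ⟨$⟩ʳ i
  π≈π′ i = toℕ-injective (F.as′-injective _ _ (F.π-index< π i) (F.π-index< π′ i)
    (trans (sym (nth-map-allFin _ i)) (trans (cong (λ z → nth z (toℕ i)) added≡) (nth-map-allFin _ i))))

maxValues : ∀ {n k} → Vec (Subset n) k → List ℕ
maxValues v = map maxValue (Vec.toList v)

nth-maxValues : ∀ {n k} (v : Vec (Subset n) k) (i : Fin k) → nth (maxValues v) (toℕ i) ≡ maxValue (lookup v i)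
nth-maxValues (s Vec.∷ ss) Fin.zero = refl
nth-maxValues (s Vec.∷ ss) (Fin.suc i) = nth-maxValues ss i

maxValuesInit : ∀ {n k} → Vec (Subset n) (suc k) → List ℕ
maxValuesInit {k = zero} (s Vec.∷ Vec.[]) = []
maxValuesInit {k = suc k} (s Vec.∷ ss) = maxValue s ∷ maxValuesInit ss

length-maxValuesInit : ∀ {n k} (v : Vec (Subset n) (suc k)) → length (maxValuesInit v) ≡ k
length-maxValuesInit {k = zero} (s Vec.∷ Vec.[]) = refl
length-maxValuesInit {k = suc k} (s Vec.∷ ss) = cong suc (length-maxValuesInit ss)

nth-maxValuesInit : ∀ {n k} (v : Vec (Subset n) (suc k)) (i : Fin k) →
  nth (maxValuesInit v) (toℕ i) ≡ maxValue (lookup v (inject₁ i))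
nth-maxValuesInit {k = suc k} (s Vec.∷ ss) Fin.zero = refl
nth-maxValuesInit {k = suc k} (s Vec.∷ ss) (Fin.suc i) = nth-maxValuesInit ss i

interlaced-maxValues : ∀ {n k} (hs Ts : Vec (Subset n) (suc k)) lo →
  (∀ i → Σ (Fin n) (λ w → (lookup (lookup hs i) w ≡ true) × (⌜ w ⌝ ≡ maxValue (lookup hs i)))) →
  (∀ i x → lookup (lookup hs i) x ≡ true → lookup (lookup Ts i) x ≡ true) →
  (∀ (i : Fin k) x y → lookup (lookup Ts (inject₁ i)) x ≡ true → lookup (lookup Ts (Fin.suc i)) y ≡ true → toℕ x < toℕ y) →
  lo < maxValue (lookup hs Fin.zero) →
  Interlaced n lo (maxValues hs) (maxValuesInit Ts)
interlaced-maxValues {n} {zero} (h₀ Vec.∷ Vec.[]) (T₀ Vec.∷ Vec.[]) lo attained _ _ lo< with attained Fin.zero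
... | w , _ , ew = lo< , subst (_≤ n) ew (⌜⌝≤n w) , refl
interlaced-maxValues {n} {suc k} (h₀ Vec.∷ h₁ Vec.∷ hs) (T₀ Vec.∷ Ts) lo attained h⊆T ordered lo<
  with attained Fin.zero | attained (Fin.suc Fin.zero)
... | w₀ , w₀∈ , ew₀ | w₁ , w₁∈ , ew₁ with maxValue-attained T₀ w₀ (h⊆T Fin.zero w₀ w₀∈)
... | t , t∈ , et =
  lo< , subst (_≤ maxValue T₀) ew₀ (maxValue-upper T₀ w₀ (h⊆T Fin.zero w₀ w₀∈)) ,
  interlaced-maxValues (h₁ Vec.∷ hs) Ts (maxValue T₀) (λ i → attained (Fin.suc i)) (λ i → h⊆T (Fin.suc i)) (λ i → ordered (Fin.suc i))
    (subst₂ _<_ et ew₁ (s≤s (ordered Fin.zero t w₁ t∈ (h⊆T (Fin.suc Fin.zero) w₁ w₁∈))))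

module MaximalChain (n l : ℕ) (h : Tuple n l) (rest : List (Tuple n l)) (maximal : IsMaximalChain n l (h ∷ rest)) where

  L : List (Tuple n l)
  L = h ∷ rest

  top : Tuple n l
  top = lastOf h rest

  L-InR : All (InR n l) L
  L-InR = proj₁ (proj₁ maximal)

  h≤ : All (h ≤R_) L
  h≤ = chain-head-least (proj₂ (proj₁ maximal))

  ≤top : All (_≤R top) L
  ≤top = chain-last-greatest (proj₂ (proj₁ maximal))

  h-InR : InR n l h
  h-InR = All.lookup L-InR (here refl)

  top-InR : InR n l top
  top-InR = All.lookup L-InR (lastOf-∈ h rest)

  ≤h⇒∈L : ∀ z → InR n l z → z ≤R h → z ∈ L
  ≤h⇒∈L z z-InR z≤h = proj₂ maximal z z-InR (All.tabulate λ {e} e∈ → inj₁ (≤R-trans {s = z} {t = h} {u = e} z≤h (All.lookup h≤ e∈)))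

  top≤⇒∈L : ∀ z → InR n l z → top ≤R z → z ∈ L
  top≤⇒∈L z z-InR top≤z = proj₂ maximal z z-InR (All.tabulate λ {e} e∈ → inj₂ (≤R-trans {s = e} {t = top} {u = z} (All.lookup ≤top e∈) top≤z))

  -- Removing the maximum of a block of h with two elements stays in R and
  -- below h, contradicting the minimality of h.
  bottom-singleton : ∀ i u → bit h i u ≡ true → ⌜ u ⌝ ≡ maxValue (lookup h i)
  bottom-singleton i u u∈ with maxValue-attained (lookup h i) u u∈
  ... | w , w∈ , ew with u ≟ w
  ... | yes refl = ew
  ... | no u≢w = ⊥-elim (true≢false (≤R⇒bit {s = h} {t = z} h≤z i w w∈) (removeAt-removed h i w))
    where
    z : Tuple n l
    z = removeAt h i w
    nonempty : ∀ j → Nonempty (lookup z j)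
    nonempty j with j ≟ i
    ... | yes refl = u , lookup⇒∈ (removeAt-kept h i w i u u∈ (inj₂ u≢w))
    ... | no j≢i with proj₁ h-InR j
    ... | v , v∈ = v , lookup⇒∈ (removeAt-kept h i w j v (∈⇒lookup v∈) (inj₁ j≢i))
    h≤z : h ≤R z
    h≤z = All.lookup h≤ (≤h⇒∈L z (InR-≤R {z = z} {t = h} h-InR nonempty (removeAt-≤R h i w)) (removeAt-≤R h i w))

  bottom-max : ∀ i → Σ (Fin n) (λ w → (bit h i w ≡ true) × (⌜ w ⌝ ≡ maxValue (lookup h i)))
  bottom-max i with proj₁ h-InR i
  ... | u , u∈ = maxValue-attained (lookup h i) u (∈⇒lookup u∈)

  interlaced : Interlaced n 0 (maxValues h) (maxValuesInit top)
  interlaced = interlaced-maxValues h top 0 bottom-max (≤R⇒bit {s = h} {t = top} (All.lookup ≤top (here refl)))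
    (λ i x y x∈ y∈ → proj₂ top-InR i (lookup⇒∈ x∈) (lookup⇒∈ y∈))
    (subst (0 <_) (proj₂ (proj₂ (bottom-max Fin.zero))) (s≤s z≤n))

  module F = Frame n l (maxValues h) (maxValuesInit top) interlaced (length-maxValuesInit top)

  top≤yT : top ≤R F.yT
  top≤yT = bit⇒≤R {s = top} {t = F.yT} λ i x e →
    trans (F.bit-restrict (λ _ → true) i x) (F.inBlockᵇ-complete (toℕ i) ⌜ x ⌝ (above-lower i x e , below-upper i x e))
    where
    above-lower : ∀ i x → bit top i x ≡ true → F.lower (toℕ i) < ⌜ x ⌝
    above-lower Fin.zero x e = s≤s z≤n
    above-lower (Fin.suc i) x e with proj₁ top-InR (inject₁ i)
    ... | u , u∈ with maxValue-attained (lookup top (inject₁ i)) u (∈⇒lookup u∈)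
    ... | t , t∈ , et = subst (_< ⌜ x ⌝) (trans et (sym (nth-maxValuesInit top i))) (s≤s (proj₂ top-InR i (lookup⇒∈ t∈) (lookup⇒∈ e)))
    below-upper : ∀ i x → bit top i x ≡ true → ⌜ x ⌝ ≤ F.upper (toℕ i)
    below-upper i x e with last⊎inject₁ i
    ... | inj₁ i≡l = subst (⌜ x ⌝ ≤_) (sym (trans (cong F.upper i≡l) F.upper-last)) (⌜⌝≤n x)
    ... | inj₂ (i′ , refl) = subst (⌜ x ⌝ ≤_) (sym upper≡max) (maxValue-upper (lookup top (inject₁ i′)) x e)
      where
      upper≡max : F.upper (toℕ (inject₁ i′)) ≡ maxValue (lookup top (inject₁ i′))
      upper≡max =
        trans (nth-++ˡ (maxValuesInit top) [ n ] (toℕ (inject₁ i′)) (subst₂ _<_ (sym (toℕ-inject₁ i′)) (sym (length-maxValuesInit top)) (toℕ<n i′)))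
          (trans (cong (nth (maxValuesInit top)) (toℕ-inject₁ i′)) (nth-maxValuesInit top i′))

  L≤yT : ∀ e → e ∈ L → e ≤R F.yT
  L≤yT e e∈ = ≤R-trans {s = e} {t = top} {u = F.yT} (All.lookup ≤top e∈) top≤yT

  L≡restrict-support : ∀ e → e ∈ L → e ≡ F.restrict (F.support e)
  L≡restrict-support e e∈ = F.≤yT⇒≡restrict-support {e} (L≤yT e e∈)

  -- Adding a missing point of yT to top stays in R and above top, contradicting
  -- the maximality of top.
  top-covers : ∀ x → F.support top ⌜ x ⌝ ≡ true
  top-covers x with F.blockOf x
  ... | i , x∈yᵢ = F.support⁺ top i x (≤R⇒bit {s = z} {t = top} z≤top i x (insertAt-inserted top i x))
    where
    z : Tuple n l
    z = insertAt top i x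
    z≤yT : z ≤R F.yT
    z≤yT = bit⇒≤R {s = z} {t = F.yT} λ j y e → from-insertAt j y (insertAt⁻ top i x j y e)
      where
      from-insertAt : ∀ j y → (bit top j y ≡ true) ⊎ (j ≡ i × y ≡ x) → bit F.yT j y ≡ true
      from-insertAt j y (inj₁ y∈) = ≤R⇒bit {s = top} {t = F.yT} top≤yT j y y∈
      from-insertAt j y (inj₂ (refl , refl)) = trans (F.bit-restrict (λ _ → true) i x) x∈yᵢ
    nonempty : ∀ j → Nonempty (lookup z j)
    nonempty j with proj₁ top-InR j
    ... | v , v∈ = v , ≤R-insertAt top i x j v∈
    z≤top : z ≤R top
    z≤top = All.lookup ≤top (top≤⇒∈L z (InR-≤R {z = z} {t = F.yT} F.yT-InR nonempty z≤yT) (≤R-insertAt top i x))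

  h≡xT : h ≡ F.xT
  h≡xT = tuple-ext λ i u → trans (≡true⇔⇒≡ (⇒ i u) (⇐ i u)) (sym (F.bit-xT i u))
    where
    ⇒ : ∀ i u → bit h i u ≡ true → (⌜ u ⌝ ≡ᵇ F.a (toℕ i)) ≡ true
    ⇒ i u e = ≡ᵇ-complete (trans (bottom-singleton i u e) (sym (nth-maxValues h i)))
    ⇐ : ∀ i u → (⌜ u ⌝ ≡ᵇ F.a (toℕ i)) ≡ true → bit h i u ≡ true
    ⇐ i u e with bottom-max i
    ... | w , w∈ , ew = subst (λ q → bit h i q ≡ true) (sym (⌜⌝-injective (trans (≡ᵇ-sound e) (trans (nth-maxValues h i) (sym ew))))) w∈

  support-mono : ∀ t t′ → t ∈ L → t′ ∈ L → t ≤R t′ → F.support t F.⊆ᵛ F.support t′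
  support-mono t t′ t∈ t′∈ t≤t′ =
    F.restrict-mono⁻ (F.support t) (F.support t′) (subst₂ _≤R_ (L≡restrict-support t t∈) (L≡restrict-support t′ t′∈) t≤t′)

  new-point : ∀ t t′ → t ∈ L → t′ ∈ L → t <R t′ →
    Σ (Fin n) (λ w → (F.support t′ ⌜ w ⌝ ≡ true) × (F.support t ⌜ w ⌝ ≡ false))
  new-point t t′ t∈ t′∈ (t≤t′ , t≢t′) = decide (any? (λ x → (F.support t′ ⌜ x ⌝ Bool.≟ true) ×-dec (F.support t ⌜ x ⌝ Bool.≟ false)))
    where
    S = F.support t
    S′ = F.support t′
    S′⊆S : ¬ Σ (Fin n) (λ w → (S′ ⌜ w ⌝ ≡ true) × (S ⌜ w ⌝ ≡ false)) → S′ F.⊆ᵛ S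
    S′⊆S no-new x e with S ⌜ x ⌝ in x∉
    ... | true = refl
    ... | false = ⊥-elim (no-new (x , e , x∉))
    decide : Dec (Σ (Fin n) (λ w → (S′ ⌜ w ⌝ ≡ true) × (S ⌜ w ⌝ ≡ false))) → Σ (Fin n) (λ w → (S′ ⌜ w ⌝ ≡ true) × (S ⌜ w ⌝ ≡ false))
    decide (yes new) = new
    decide (no no-new) = ⊥-elim (t≢t′ (trans (L≡restrict-support t t∈)
      (trans (F.restrict-cong S S′ (F.⊆ᵛ-antisym S S′ (support-mono t t′ t∈ t′∈ t≤t′) (S′⊆S no-new))) (sym (L≡restrict-support t′ t′∈)))))

  -- If nothing in L lies strictly between t < t′, their supports differ in
  -- exactly one point: adding a single new point to t gives an element of R
  -- comparable with all of L, hence in L, hence above t′.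
  covering-step : ∀ t t′ → t ∈ L → t′ ∈ L → t <R t′ → (∀ e → e ∈ L → (e ≤R t) ⊎ (t′ ≤R e)) →
    Σ (Fin n) (λ w → (F.support t ⌜ w ⌝ ≡ false) × (F.support t′ F.≈ᵛ F.add (F.support t) ⌜ w ⌝))
  covering-step t t′ t∈ t′∈ t<t′ cut = w , w∉S , F.⊆ᵛ-antisym S′ (F.add S ⌜ w ⌝) (S′⊆ (cut z (proj₂ maximal z z-InR z-comparable))) ⊆S′
    where
    S = F.support t
    S′ = F.support t′
    w = proj₁ (new-point t t′ t∈ t′∈ t<t′)
    w∈S′ = proj₁ (proj₂ (new-point t t′ t∈ t′∈ t<t′))
    w∉S = proj₂ (proj₂ (new-point t t′ t∈ t′∈ t<t′))
    ⊆S′ : F.add S ⌜ w ⌝ F.⊆ᵛ S′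
    ⊆S′ x e with ∨-true⁻ {S ⌜ x ⌝} e
    ... | inj₁ x∈S = support-mono t t′ t∈ t′∈ (proj₁ t<t′) x x∈S
    ... | inj₂ x≡w = subst (λ q → S′ q ≡ true) (sym (≡ᵇ-sound x≡w)) w∈S′
    z : Tuple n l
    z = F.restrict (F.add S ⌜ w ⌝)
    t≤z : t ≤R z
    t≤z = subst (_≤R z) (sym (L≡restrict-support t t∈)) (F.restrict-mono S (F.add S ⌜ w ⌝) (F.⊆ᵛ-add S ⌜ w ⌝))
    z≤t′ : z ≤R t′
    z≤t′ = subst (z ≤R_) (sym (L≡restrict-support t′ t′∈)) (F.restrict-mono (F.add S ⌜ w ⌝) S′ ⊆S′)
    z-InR : InR n l z
    z-InR = InR-≤R {z = z} {t = F.yT} F.yT-InR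
      (λ j → proj₁ (proj₁ (All.lookup L-InR t∈) j) , t≤z j (proj₂ (proj₁ (All.lookup L-InR t∈) j)))
      (≤R-trans {s = z} {t = t′} {u = F.yT} z≤t′ (L≤yT t′ t′∈))
    comparable : ∀ e → (e ≤R t) ⊎ (t′ ≤R e) → Comparable z e
    comparable e (inj₁ e≤t) = inj₂ (≤R-trans {s = e} {t = t} {u = z} e≤t t≤z)
    comparable e (inj₂ t′≤e) = inj₁ (≤R-trans {s = z} {t = t′} {u = e} z≤t′ t′≤e)
    z-comparable : All (Comparable z) L
    z-comparable = All.tabulate λ {e} e∈ → comparable e (cut e e∈)
    S′⊆ : (z ≤R t) ⊎ (t′ ≤R z) → S′ F.⊆ᵛ F.add S ⌜ w ⌝
    S′⊆ (inj₁ z≤t) = ⊥-elim (true≢false (F.restrict-mono⁻ (F.add S ⌜ w ⌝) S (subst (z ≤R_) (L≡restrict-support t t∈) z≤t) w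
                        (∨-trueʳ {S ⌜ w ⌝} (≡ᵇ-refl ⌜ w ⌝))) w∉S)
    S′⊆ (inj₂ t′≤z) = F.restrict-mono⁻ S′ (F.add S ⌜ w ⌝) (subst (_≤R z) (L≡restrict-support t′ t′∈) t′≤z)

  Walk : Tuple n l → List (Tuple n l) → Set
  Walk t ts = Σ (List ℕ) (λ vs → F.Fresh (F.support t) vs × (F.chainOf (F.support t) vs ≡ t ∷ ts) ×
                                   (F.final (F.support t) vs F.≈ᵛ F.support (lastOf t ts)))

  walk : ∀ t ts → (∀ e → e ∈ L → (e ≤R t) ⊎ (e ∈ ts)) → Linked _<R_ (t ∷ ts) → (∀ e → e ∈ t ∷ ts → e ∈ L) → Walk t ts
  walk t [] _ _ ⊆L = [] , tt , cong (_∷ []) (sym (L≡restrict-support t (⊆L t (here refl)))) , λ _ → refl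
  walk t (t′ ∷ ts) cut (t<t′ ∷ linked) ⊆L =
    ⌜ w ⌝ ∷ vs , ((w , refl) , w∉ , Fresh-vs) , cong₂ _∷_ (sym (L≡restrict-support t t∈)) chainOf-vs , final-vs
    where
    t∈ = ⊆L t (here refl)
    t′∈ = ⊆L t′ (there (here refl))
    below-or-above : ∀ {e} → (e ≤R t) ⊎ (e ∈ t′ ∷ ts) → (e ≤R t) ⊎ (t′ ≤R e)
    below-or-above (inj₁ e≤t) = inj₁ e≤t
    below-or-above (inj₂ e∈) = inj₂ (All.lookup (chain-head-least linked) e∈)
    step = covering-step t t′ t∈ t′∈ t<t′ (λ e e∈ → below-or-above (cut e e∈))
    w = proj₁ step
    w∉ = proj₁ (proj₂ step)
    S′≈ = proj₂ (proj₂ step)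
    cut′ : ∀ e → e ∈ L → (e ≤R t′) ⊎ (e ∈ ts)
    cut′ e e∈ with cut e e∈
    ... | inj₁ e≤t = inj₁ (≤R-trans {s = e} {t = t} {u = t′} e≤t (proj₁ t<t′))
    ... | inj₂ (here refl) = inj₁ (≤R-refl {t = t′})
    ... | inj₂ (there e∈ts) = inj₂ e∈ts
    IH = walk t′ ts cut′ linked (λ e e∈ → ⊆L e (there e∈))
    vs = proj₁ IH
    Fresh-vs = F.Fresh-cong _ _ vs S′≈ (proj₁ (proj₂ IH))
    chainOf-vs = trans (sym (F.chainOf-cong _ _ vs S′≈)) (proj₁ (proj₂ (proj₂ IH)))
    final-vs : F.final (F.add (F.support t) ⌜ w ⌝) vs F.≈ᵛ F.support (lastOf t′ ts)
    final-vs x = trans (sym (F.final-cong _ _ vs S′≈ x)) (proj₂ (proj₂ (proj₂ IH)) x)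

  recorded : Walk h rest
  recorded = walk h rest below-or-in (proj₂ (proj₁ maximal)) (λ e e∈ → e∈)
    where
    below-or-in : ∀ e → e ∈ L → (e ≤R h) ⊎ (e ∈ rest)
    below-or-in e (here refl) = inj₁ (≤R-refl {t = h})
    below-or-in e (there e∈) = inj₂ e∈

  added : List ℕ
  added = proj₁ recorded

  support-h≈Sx : F.support h F.≈ᵛ F.Sx
  support-h≈Sx = F.restrict-injective (F.support h) F.Sx (trans (sym (L≡restrict-support h (here refl))) (trans h≡xT F.xT≡restrict-Sx))

  added-Fresh : F.Fresh F.Sx added
  added-Fresh = F.Fresh-cong _ _ added support-h≈Sx (proj₁ (proj₂ recorded))

  chainOf-added : F.chainOf F.Sx added ≡ L
  chainOf-added = trans (sym (F.chainOf-cong _ _ added support-h≈Sx)) (proj₁ (proj₂ (proj₂ recorded)))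

  added-covers : ∀ x → F.final F.Sx added ⌜ x ⌝ ≡ true
  added-covers x = trans (sym (F.final-cong _ _ added support-h≈Sx x)) (trans (proj₂ (proj₂ (proj₂ recorded)) x) (top-covers x))

AllPairs-≢⇒nth-injective : ∀ (xs : List ℕ) → AllPairs _≢_ xs →
  ∀ i j → i < length xs → j < length xs → nth xs i ≡ nth xs j → i ≡ j
AllPairs-≢⇒nth-injective (x ∷ xs) (_ ∷ _) zero zero _ _ _ = refl
AllPairs-≢⇒nth-injective (x ∷ xs) (x∉ ∷ _) zero (suc j) _ (s≤s j<len) e = ⊥-elim (nth-All xs j x∉ j<len e)
AllPairs-≢⇒nth-injective (x ∷ xs) (x∉ ∷ _) (suc i) zero (s≤s i<len) _ e = ⊥-elim (nth-All xs i x∉ i<len (sym e))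
AllPairs-≢⇒nth-injective (x ∷ xs) (_ ∷ distinct) (suc i) (suc j) (s≤s i<len) (s≤s j<len) e =
  cong suc (AllPairs-≢⇒nth-injective xs distinct i j i<len j<len e)

module IndexBijection (xs ys : List ℕ)
  (xs-injective : ∀ i j → i < length xs → j < length xs → nth xs i ≡ nth xs j → i ≡ j)
  (ys-injective : ∀ i j → i < length ys → j < length ys → nth ys i ≡ nth ys j → i ≡ j)
  (xs⊆ys : ∀ j → j < length xs → Σ ℕ (λ k → (k < length ys) × (nth ys k ≡ nth xs j)))
  (ys⊆xs : ∀ k → k < length ys → Σ ℕ (λ j → (j < length xs) × (nth xs j ≡ nth ys k))) where

  module _ (a b : ℕ) (length-xs : length xs ≡ a) (length-ys : length ys ≡ b) where

    index<ˣ : (j : Fin a) → toℕ j < length xs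
    index<ˣ j = subst (toℕ j <_) (sym length-xs) (toℕ<n j)

    index<ʸ : (k : Fin b) → toℕ k < length ys
    index<ʸ k = subst (toℕ k <_) (sym length-ys) (toℕ<n k)

    to : Fin a → Fin b
    to j = fromℕ< (subst (proj₁ (xs⊆ys (toℕ j) (index<ˣ j)) <_) length-ys (proj₁ (proj₂ (xs⊆ys (toℕ j) (index<ˣ j)))))

    from : Fin b → Fin a
    from k = fromℕ< (subst (proj₁ (ys⊆xs (toℕ k) (index<ʸ k)) <_) length-xs (proj₁ (proj₂ (ys⊆xs (toℕ k) (index<ʸ k)))))

    nth-to : ∀ j → nth ys (toℕ (to j)) ≡ nth xs (toℕ j)
    nth-to j = trans (cong (nth ys) (toℕ-fromℕ< _)) (proj₂ (proj₂ (xs⊆ys (toℕ j) (index<ˣ j))))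

    nth-from : ∀ k → nth xs (toℕ (from k)) ≡ nth ys (toℕ k)
    nth-from k = trans (cong (nth xs) (toℕ-fromℕ< _)) (proj₂ (proj₂ (ys⊆xs (toℕ k) (index<ʸ k))))

    bijection : Permutation a b
    bijection = permutation to from
      (λ k → toℕ-injective (ys-injective _ _ (index<ʸ (to (from k))) (index<ʸ k) (trans (nth-to (from k)) (nth-from k))))
      (λ j → toℕ-injective (xs-injective _ _ (index<ˣ (from (to j))) (index<ˣ j) (trans (nth-from (to j)) (nth-to j))))

  length-xs≡length-ys : length xs ≡ length ys
  length-xs≡length-ys = ↔⇒≡ (bijection (length xs) (length ys) refl refl)

singletons-InR : ∀ n l → l < n → Σ (Tuple n l) (InR n l)
singletons-InR n l l<n = t , nonempty , ordered
  where
  t : Tuple n l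
  t = tabulate (λ i → ofPred (λ v → v ≡ᵇ suc (toℕ i)))
  bit-t : ∀ i x → bit t i x ≡ (⌜ x ⌝ ≡ᵇ suc (toℕ i))
  bit-t i x = trans (cong (λ s → lookup s x) (lookup∘tabulate (λ i → ofPred (λ v → v ≡ᵇ suc (toℕ i))) i))
                    (lookup-ofPred (λ v → v ≡ᵇ suc (toℕ i)) x)
  nonempty : ∀ i → Nonempty (lookup t i)
  nonempty i with fromValue (suc (toℕ i)) (s≤s z≤n) (≤-trans (toℕ<n i) l<n)
  ... | w , ew = w , lookup⇒∈ (trans (bit-t i w) (≡ᵇ-complete ew))
  ordered : ∀ (i : Fin l) {x y : Fin n} → x ∈ₛ lookup t (inject₁ i) → y ∈ₛ lookup t (Fin.suc i) → x Fin.< y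
  ordered i {x} {y} x∈ y∈ = ≤-pred (subst₂ _<_ (sym ex) (sym ey) (s≤s (s≤s (≤-reflexive (toℕ-inject₁ i)))))
    where
    ex : ⌜ x ⌝ ≡ suc (toℕ (inject₁ i))
    ex = ≡ᵇ-sound (trans (sym (bit-t (inject₁ i) x)) (∈⇒lookup x∈))
    ey : ⌜ y ⌝ ≡ suc (suc (toℕ i))
    ey = ≡ᵇ-sound (trans (sym (bit-t (Fin.suc i) y)) (∈⇒lookup y∈))

-- A maximal chain, recorded as a frame (as, bs) and the list vs of points
-- added along it, is C(A, π) for the A encoding the frame and the π ordering vs.
module Reconstruct (n l : ℕ) (as bs : List ℕ) (interlaced : Interlaced n 0 as bs) (length-bs : length bs ≡ l)
  (L : List (Tuple n l)) (vs : List ℕ)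
  (vs-Fresh : FrameDefs.Fresh n l as bs (FrameDefs.Sx n l as bs) vs)
  (chainOf-vs : FrameDefs.chainOf n l as bs (FrameDefs.Sx n l as bs) vs ≡ L)
  (vs-covers : ∀ (x : Fin n) → FrameDefs.final n l as bs (FrameDefs.Sx n l as bs) vs ⌜ x ⌝ ≡ true) where

  A : Subset (n + l)
  A = ofPred {n + l} (λ v → any (v ≡ᵇ_) (encode 0 as bs))

  elemsℕ-A : elemsℕ A ≡ encode 0 as bs
  elemsℕ-A = elemsℕ-ofPred (n + l) (λ v → any (v ≡ᵇ_) (encode 0 as bs)) (encode 0 as bs) (λ x → refl) (encode-Ascending {n} 0 as bs interlaced)
    (subst (λ q → All (_≤ q) (encode 0 as bs)) (trans (cong (_+ n) length-bs) (+-comm l n)) (encode-bounded {n} 0 as bs interlaced))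

  |A|≡ : ∣ A ∣ ≡ 2 * l + 1
  |A|≡ = trans (sym (length-elemsℕ A))
    (trans (cong length elemsℕ-A) (trans (length-encode {n} 0 as bs interlaced)
      (trans (cong (λ q → suc (double q)) length-bs) (sym (2*p+1≡suc-double l)))))

  as≡ : C.as n l A ≡ as
  as≡ = trans (cong (λ z → subIdx 0 (odds z)) elemsℕ-A) (odds-encode {n} 0 as bs interlaced)

  bs≡ : C.bs n l A ≡ bs
  bs≡ = trans (cong (λ z → subIdx 1 (evens z)) elemsℕ-A) (evens-encode {n} 0 as bs interlaced)

  Recorded : List ℕ → List ℕ → Set
  Recorded as′ bs′ =
    FrameDefs.Fresh n l as′ bs′ (FrameDefs.Sx n l as′ bs′) vs × (FrameDefs.chainOf n l as′ bs′ (FrameDefs.Sx n l as′ bs′) vs ≡ L) ×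
    (∀ (x : Fin n) → FrameDefs.final n l as′ bs′ (FrameDefs.Sx n l as′ bs′) vs ⌜ x ⌝ ≡ true)

  transport : ∀ as′ bs′ → as′ ≡ as → bs′ ≡ bs → Recorded as′ bs′
  transport _ _ refl refl = vs-Fresh , chainOf-vs , vs-covers

  module F = FrameOf n l A |A|≡

  recorded : Recorded (C.as n l A) (C.bs n l A)
  recorded = transport _ _ as≡ bs≡

  vs-outside = F.Fresh⇒outside F.Sx vs (proj₁ recorded)

  vs⊆as′ : ∀ j → j < length vs → Σ ℕ (λ k → (k < length F.as′) × (nth F.as′ k ≡ nth vs j))
  vs⊆as′ j j<len with nth-All vs j vs-outside j<len
  ... | (w , ew) , w∉ with F.as′-index w (subst (λ q → F.Sx q ≡ false) (sym ew) w∉)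
  ... | k , k<len , ek = k , k<len , trans ek ew

  as′⊆vs : ∀ k → k < length F.as′ → Σ ℕ (λ j → (j < length vs) × (nth vs j ≡ nth F.as′ k))
  as′⊆vs k k<len with F.as′-nth k k<len
  ... | x , ex , x∉ with F.final⁻ F.Sx vs ⌜ x ⌝ (proj₂ (proj₂ recorded) x)
  ... | inj₁ x∈ = ⊥-elim (true≢false x∈ x∉)
  ... | inj₂ (j , j<len , ej) = j , j<len , trans ej ex

  module B = IndexBijection vs F.as′ (AllPairs-≢⇒nth-injective vs (F.Fresh-distinct F.Sx vs (proj₁ recorded)))
                              F.as′-injective vs⊆as′ as′⊆vs

  length-vs : length vs ≡ F.m
  length-vs = trans B.length-xs≡length-ys F.length-as′

  π : Permutation′ F.m
  π = B.bijection F.m F.m length-vs F.length-as′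

  added≡vs : F.added π ≡ vs
  added≡vs = nth-ext _ _ (trans (length-map-allFin _) (sym length-vs)) λ k k<len →
    let k<m = subst (k <_) (length-map-allFin _) k<len
    in trans (cong (nth (F.added π)) (sym (toℕ-fromℕ< k<m)))
         (trans (nth-map-allFin _ (fromℕ< k<m))
           (trans (B.nth-to F.m F.m length-vs F.length-as′ (fromℕ< k<m)) (cong (nth vs) (toℕ-fromℕ< k<m))))

  chainC≡L : chainC n l A π ≡ L
  chainC≡L = trans (F.chainC≡chainOf π) (trans (cong (F.chainOf F.Sx) added≡vs) (proj₁ (proj₂ recorded)))

chainC-surjective : ∀ n l → l < n → (L : List (Tuple n l)) → IsMaximalChain n l L →
  Σ (Subset (n + l)) (λ A → (∣ A ∣ ≡ 2 * l + 1) × Σ (Permutation′ (n ∸ suc l)) (λ π → chainC n l A π ≡ L))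
chainC-surjective n l l<n [] maximal with singletons-InR n l l<n
... | t , t-InR with proj₂ maximal t t-InR []
... | ()
chainC-surjective n l l<n (h ∷ rest) maximal = R.A , R.|A|≡ , R.π , R.chainC≡L
  where
  module M = MaximalChain n l h rest maximal
  module R = Reconstruct n l (maxValues h) (maxValuesInit M.top) M.interlaced (length-maxValuesInit M.top)
                         (h ∷ rest) M.added M.added-Fresh M.chainOf-added M.added-covers

length-concatMap-const : ∀ {A B : Set} (f : A → List B) c (xs : List A) → (∀ x → length (f x) ≡ c) →
  length (concatMap f xs) ≡ length xs * c
length-concatMap-const f c [] _ = refl
length-concatMap-const f c (x ∷ xs) h = trans (length-++ (f x)) (cong₂ _+_ (h x) (length-concatMap-const f c xs h))

AllPairs-concatMap-map : ∀ {A B C : Set} {Q : A → Set} {R : B → B → Set} {S : C → C → Set} (g : A → B → C) {ys} →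
  AllPairs R ys →
  (∀ {a} → Q a → ∀ {b b′} → R b b′ → S (g a b) (g a b′)) →
  (∀ {a a′} → Q a → Q a′ → a ≢ a′ → ∀ b b′ → S (g a b) (g a′ b′)) →
  ∀ {xs} → All Q xs → AllPairs _≢_ xs → AllPairs S (concatMap (λ a → map (g a) ys) xs)
AllPairs-concatMap-map g R-ys within across [] [] = []
AllPairs-concatMap-map {Q = Q} {S = S} g {ys} R-ys within across {a ∷ _} (q ∷ qs) (a∉ ∷ distinct) =
  AllPairs.++⁺ (AllPairs.map⁺ (AllPairs.map (within q) R-ys)) (AllPairs-concatMap-map g R-ys within across qs distinct)
    (All.map⁺ (All.universal (λ b → All.concat⁺ (All.map⁺ (All.map (across-all b) (All.zip (qs , a∉))))) ys))
  where
  across-all : ∀ b {a′} → Q a′ × a ≢ a′ → All (S (g a b)) (map (g a′) ys)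
  across-all b (q′ , a≢a′) = All.map⁺ (All.universal (across q q′ a≢a′ b) ys)

_≈ₚ_ : ∀ {m} → Permutation′ m → Permutation′ m → Set
π ≈ₚ σ = ∀ i → π ⟨$⟩ʳ i ≡ σ ⟨$⟩ʳ i

-- Every permutation of Fin (suc m) is insert 0 j σ for its image j of 0.
permutations : (m : ℕ) → List (Permutation′ m)
permutations zero = [ Perm.id ]
permutations (suc m) = concatMap (λ j → map (insert Fin.zero j) (permutations m)) (allFin (suc m))

length-permutations : ∀ m → length (permutations m) ≡ m !
length-permutations zero = refl
length-permutations (suc m) =
  trans (length-concatMap-const (λ j → map (insert Fin.zero j) (permutations m)) (m !) (allFin (suc m))
      (λ j → trans (length-map (insert Fin.zero j) (permutations m)) (length-permutations m)))
        (cong (_* (m !)) (length-tabulate {n = suc m} (λ x → x)))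

insert-zero : ∀ {m} j (σ : Permutation′ m) → insert Fin.zero j σ ⟨$⟩ʳ Fin.zero ≡ j
insert-zero {m} j σ with Fin.zero {n = m} ≟ Fin.zero
... | yes _ = refl
... | no 0≢0 with () ← 0≢0 refl

permutations-complete : ∀ m (π : Permutation′ m) → Σ (Permutation′ m) (λ σ → (σ ∈ permutations m) × (σ ≈ₚ π))
permutations-complete zero π = Perm.id , here refl , λ ()
permutations-complete (suc m) π with permutations-complete m (remove Fin.zero π)
... | σ , σ∈ , σ≈ =
  insert Fin.zero j σ ,
  ∈-concat⁺′ (∈-map⁺ (insert Fin.zero j) σ∈) (∈-map⁺ (λ j → map (insert Fin.zero j) (permutations m)) (∈-allFin j)) ,
  ≈π
  where
  j = π ⟨$⟩ʳ Fin.zero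
  ≈π : insert Fin.zero j σ ≈ₚ π
  ≈π Fin.zero = insert-zero j σ
  ≈π (Fin.suc k) = trans (insert-punchIn Fin.zero j σ k)
    (trans (cong (punchIn j) (σ≈ k)) (trans (sym (insert-punchIn Fin.zero j (remove Fin.zero π) k)) (insert-remove Fin.zero π (Fin.suc k))))

permutations-distinct : ∀ m → AllPairs (λ σ σ′ → ¬ (σ ≈ₚ σ′)) (permutations m)
permutations-distinct zero = [] ∷ []
permutations-distinct (suc m) =
  AllPairs-concatMap-map {Q = λ _ → Fin (suc m)} (insert Fin.zero) (permutations-distinct m) within across
    (All.universal (λ j → j) (allFin (suc m))) (Unique.allFin⁺ (suc m))
  where
  within : ∀ {j} → Fin (suc m) → ∀ {σ σ′} → ¬ (σ ≈ₚ σ′) → ¬ (insert Fin.zero j σ ≈ₚ insert Fin.zero j σ′)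
  within {j} _ {σ} {σ′} σ≉σ′ e = σ≉σ′ λ k →
    punchIn-injective j _ _ (trans (sym (insert-punchIn Fin.zero j σ k)) (trans (e (Fin.suc k)) (insert-punchIn Fin.zero j σ′ k)))
  across : ∀ {j j′} → Fin (suc m) → Fin (suc m) → j ≢ j′ → ∀ σ σ′ → ¬ (insert Fin.zero j σ ≈ₚ insert Fin.zero j′ σ′)
  across {j} {j′} _ _ j≢j′ σ σ′ e = j≢j′ (trans (sym (insert-zero j σ)) (trans (e Fin.zero) (insert-zero j′ σ′)))

subsetsOfSize : (m k : ℕ) → List (Subset m)
subsetsOfSize zero zero = [ Vec.[] ]
subsetsOfSize zero (suc k) = []
subsetsOfSize (suc m) zero = map (false Vec.∷_) (subsetsOfSize m zero)
subsetsOfSize (suc m) (suc k) = map (true Vec.∷_) (subsetsOfSize m k) ++ map (false Vec.∷_) (subsetsOfSize m (suc k))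

length-subsetsOfSize : ∀ m k → length (subsetsOfSize m k) ≡ m C k
length-subsetsOfSize zero zero = refl
length-subsetsOfSize zero (suc k) = refl
length-subsetsOfSize (suc m) zero = trans (length-map _ (subsetsOfSize m zero)) (length-subsetsOfSize m zero)
length-subsetsOfSize (suc m) (suc k) =
  trans (length-++ (map (true Vec.∷_) (subsetsOfSize m k)))
    (trans (cong₂ _+_ (trans (length-map _ (subsetsOfSize m k)) (length-subsetsOfSize m k))
                      (trans (length-map _ (subsetsOfSize m (suc k))) (length-subsetsOfSize m (suc k))))
           (nCk+nC[k+1]≡[n+1]C[k+1] m k))

subsetsOfSize-complete : ∀ m k (A : Subset m) → ∣ A ∣ ≡ k → A ∈ subsetsOfSize m k
subsetsOfSize-complete zero zero Vec.[] _ = here refl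
subsetsOfSize-complete (suc m) (suc k) (true Vec.∷ A) e = ∈-++⁺ˡ (∈-map⁺ (true Vec.∷_) (subsetsOfSize-complete m k A (suc-injective e)))
subsetsOfSize-complete (suc m) zero (false Vec.∷ A) e = ∈-map⁺ (false Vec.∷_) (subsetsOfSize-complete m zero A e)
subsetsOfSize-complete (suc m) (suc k) (false Vec.∷ A) e =
  ∈-++⁺ʳ (map (true Vec.∷_) (subsetsOfSize m k)) (∈-map⁺ (false Vec.∷_) (subsetsOfSize-complete m (suc k) A e))

subsetsOfSize-sound : ∀ m k (A : Subset m) → A ∈ subsetsOfSize m k → ∣ A ∣ ≡ k
subsetsOfSize-sound zero zero Vec.[] _ = refl
subsetsOfSize-sound (suc m) zero A A∈ with ∈-map⁻ (false Vec.∷_) A∈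
... | B , B∈ , refl = subsetsOfSize-sound m zero B B∈
subsetsOfSize-sound (suc m) (suc k) A A∈ with ∈-++⁻ (map (true Vec.∷_) (subsetsOfSize m k)) A∈
... | inj₁ A∈ˡ with ∈-map⁻ (true Vec.∷_) A∈ˡ
...   | B , B∈ , refl = cong suc (subsetsOfSize-sound m k B B∈)
subsetsOfSize-sound (suc m) (suc k) A A∈ | inj₂ A∈ʳ with ∈-map⁻ (false Vec.∷_) A∈ʳ
...   | B , B∈ , refl = subsetsOfSize-sound m (suc k) B B∈

subsetsOfSize-unique : ∀ m k → Unique (subsetsOfSize m k)
subsetsOfSize-unique zero zero = [] ∷ []
subsetsOfSize-unique zero (suc k) = []
subsetsOfSize-unique (suc m) zero = Unique.map⁺ (cong Vec.tail) (subsetsOfSize-unique m zero)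
subsetsOfSize-unique (suc m) (suc k) =
  Unique.++⁺ (Unique.map⁺ (cong Vec.tail) (subsetsOfSize-unique m k)) (Unique.map⁺ (cong Vec.tail) (subsetsOfSize-unique m (suc k))) disjoint
  where
  disjoint : ∀ {v} → v ∈ map (true Vec.∷_) (subsetsOfSize m k) × v ∈ map (false Vec.∷_) (subsetsOfSize m (suc k)) → ⊥
  disjoint (v∈ˡ , v∈ʳ) with ∈-map⁻ (true Vec.∷_) v∈ˡ | ∈-map⁻ (false Vec.∷_) v∈ʳ
  ... | _ , _ , refl | _ , _ , ()

chainC-cong : ∀ n l (A : Subset (n + l)) (σ π : Permutation′ (n ∸ suc l)) → σ ≈ₚ π → chainC n l A σ ≡ chainC n l A π
chainC-cong n l A σ π σ≈π = cong (Construction.chainFrom n l A (Construction.x n l A))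
  (map-cong (λ j → cong (λ q → nth (Construction.as′ n l A) (toℕ q)) (σ≈π j)) (allFin (n ∸ suc l)))

allChains : ∀ n l → List (List (Tuple n l))
allChains n l = concatMap (λ A → map (chainC n l A) (permutations (n ∸ suc l))) (subsetsOfSize (n + l) (2 * l + 1))

allChains-unique : ∀ n l → Unique (allChains n l)
allChains-unique n l =
  AllPairs-concatMap-map {Q = λ A → ∣ A ∣ ≡ 2 * l + 1} (chainC n l) (permutations-distinct (n ∸ suc l))
    (λ |A|≡ {σ} {σ′} σ≉σ′ e → σ≉σ′ (proj₂ (chainC-injective n l _ _ |A|≡ |A|≡ σ σ′ e)))
    (λ |A|≡ |A′|≡ A≢A′ σ σ′ e → A≢A′ (proj₁ (chainC-injective n l _ _ |A|≡ |A′|≡ σ σ′ e)))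
    (All.tabulate (subsetsOfSize-sound (n + l) (2 * l + 1) _)) (subsetsOfSize-unique (n + l) (2 * l + 1))

length-allChains : ∀ n l → length (allChains n l) ≡ ((n + l) C (2 * l + 1)) * ((n ∸ suc l) !)
length-allChains n l =
  trans (length-concatMap-const _ ((n ∸ suc l) !) (subsetsOfSize (n + l) (2 * l + 1))
          (λ A → trans (length-map (chainC n l A) (permutations (n ∸ suc l))) (length-permutations (n ∸ suc l))))
        (cong (_* ((n ∸ suc l) !)) (length-subsetsOfSize (n + l) (2 * l + 1)))

maximal⇒∈allChains : ∀ n l → l < n → (L : List (Tuple n l)) → IsMaximalChain n l L → L ∈ allChains n l
maximal⇒∈allChains n l l<n L maximal with chainC-surjective n l l<n L maximal
... | A , |A|≡ , π , chainC≡L with permutations-complete (n ∸ suc l) π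
... | σ , σ∈ , σ≈π = subst (_∈ allChains n l) (trans (chainC-cong n l A σ π σ≈π) chainC≡L)
  (∈-concat⁺′ (∈-map⁺ (chainC n l A) σ∈) (∈-map⁺ (λ A → map (chainC n l A) (permutations (n ∸ suc l)))
    (subsetsOfSize-complete (n + l) (2 * l + 1) A |A|≡)))

∈allChains⇒maximal : ∀ n l (L : List (Tuple n l)) → L ∈ allChains n l → IsMaximalChain n l L
∈allChains⇒maximal n l L L∈ with ∈-concat⁻′ (map (λ A → map (chainC n l A) (permutations (n ∸ suc l))) (subsetsOfSize (n + l) (2 * l + 1))) L∈
... | Ls , L∈Ls , Ls∈ with ∈-map⁻ (λ A → map (chainC n l A) (permutations (n ∸ suc l))) Ls∈
... | A , A∈ , refl with ∈-map⁻ (chainC n l A) L∈Ls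
... | σ , _ , refl = FrameOf.chainC-maximal n l A (subsetsOfSize-sound (n + l) (2 * l + 1) A A∈) σ

proposition3p8 : (n l : ℕ) → l < n →
    ((A : Subset (n + l)) → ∣ A ∣ ≡ 2 * l + 1 → (π : Permutation′ (n ∸ suc l)) →
       IsMaximalChain n l (chainC n l A π))
    × ((A A′ : Subset (n + l)) → ∣ A ∣ ≡ 2 * l + 1 → ∣ A′ ∣ ≡ 2 * l + 1 →
       (π π′ : Permutation′ (n ∸ suc l)) → chainC n l A π ≡ chainC n l A′ π′ →
       A ≡ A′ × (∀ i → π ⟨$⟩ʳ i ≡ π′ ⟨$⟩ʳ i))
    × ((L : List (Tuple n l)) → IsMaximalChain n l L →
       Σ (Subset (n + l)) (λ A → ∣ A ∣ ≡ 2 * l + 1 ×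
         Σ (Permutation′ (n ∸ suc l)) (λ π → chainC n l A π ≡ L)))
    × Σ (List (List (Tuple n l))) (λ Ls → Unique Ls ×
         length Ls ≡ ((n + l) C (2 * l + 1)) * ((n ∸ suc l) !) ×
         ((L : List (Tuple n l)) → (IsMaximalChain n l L → L ∈ Ls) × (L ∈ Ls → IsMaximalChain n l L)))
proposition3p8 n l l<n =
  FrameOf.chainC-maximal n l ,
  chainC-injective n l ,
  chainC-surjective n l l<n ,
  allChains n l , allChains-unique n l , length-allChains n l ,
  λ L → maximal⇒∈allChains n l l<n L , ∈allChains⇒maximal n l L
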